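{- Let $p$ be an odd prime, $s$ an integer whose class generates $(\mathbf Z/p)^\times$, and $x,y\in(\mathbf Z/p)^\times$ with $x-y=1$. Let $R=\mathbf Z/p[X]/(X^p-1)$, $t$ the class of $X$, and for $1\le k\le(p-1)/2$ let $z_k(x)$ be the class of $(x-yt^{s^k})(x-yt^{ -s^k})^{ -1}$ in $R^\times/(R^\times)^p$. Let $V(x)$ be the $\mathbf Z/p$-subspace of $R^\times/(R^\times)^p$ spanned by $z_1(x),\dots,z_{(p-1)/2}(x)$. Then $\dim_{\mathbf Z/p}V(x)\geq r_p(x/y)$.
   Context: $R$ is local and $x-yt^{\pm s^k}$ are units of $R$; $R^\times/(R^\times)^p\cong K_1(R;\mathbf Z/p)\cong1+(1-t)\mathbf Z/p[t]$ is a $\mathbf Z/p$-vector space (written multiplicatively). Mirimanoff polynomials: $M_k(X)=\sum_{j=1}^{p-1}j^{k-1}X^j\in\mathbf Z/p[X]$; for $u\in\mathbf Z/p$, $r_p(u)=\#\{k:1\le k\le(p-1)/2,\ M_{2k+1}(u)\neq0\}$. -}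

module Defs where

open import Data.Nat using (ℕ; zero; suc; _+_; _*_; _∸_; _^_; _≟_; NonZero)
open import Data.Nat.DivMod using (_%_; _/_; m%n<n)
open import Data.Fin using (Fin; toℕ; fromℕ<)
open import Data.List using (List; map; foldr; allFin; upTo; filter; length)
open import Data.Nat.ListAction using (sum)
open import Data.Product using (Σ; ∃; _×_)
open import Relation.Nullary using (¬_; ¬?)
open import Relation.Nullary.Decidable using (does)
open import Relation.Binary.PropositionalEquality using (_≡_)
open import Data.Bool using (if_then_else_)

-- Z/p is represented by ℕ, two naturals being equal in Z/p iff congruent mod p.
-- R = Z/p[X]/(X^p - 1): an element is its coefficient vector (a_0,...,a_{p-1}),
-- representing  Σ a_i t^i ; two elements are equal in R iff coefficients agree mod p.
R : ℕ → Set
R p = Fin p → ℕ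

ix : (p : ℕ) .{{_ : NonZero p}} → ℕ → Fin p
ix p n = fromℕ< (m%n<n n p)

EqR : (p : ℕ) .{{_ : NonZero p}} → R p → R p → Set
EqR p f g = ∀ i → f i % p ≡ g i % p

sumFin : (n : ℕ) → (Fin n → ℕ) → ℕ
sumFin n f = sum (map f (allFin n))

mulR : (p : ℕ) .{{_ : NonZero p}} → R p → R p → R p
mulR p f g k = sumFin p (λ i → f i * g (ix p (toℕ k + p ∸ toℕ i)))

oneR : (p : ℕ) .{{_ : NonZero p}} → R p
oneR p i = if does (toℕ i ≟ 0) then 1 else 0

powR : (p : ℕ) .{{_ : NonZero p}} → R p → ℕ → R p
powR p f zero    = oneR p
powR p f (suc n) = mulR p f (powR p f n)

prodPowR : (p : ℕ) .{{_ : NonZero p}} (m : ℕ) → (Fin m → R p) → (Fin m → ℕ) → R p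
prodPowR p m f e = foldr (λ k acc → mulR p (powR p (f k) (e k)) acc) (oneR p) (allFin m)

IsUnit : (p : ℕ) .{{_ : NonZero p}} → R p → Set
IsUnit p u = Σ (R p) λ v → EqR p (mulR p u v) (oneR p)

IsPthPowerOfUnit : (p : ℕ) .{{_ : NonZero p}} → R p → Set
IsPthPowerOfUnit p u = Σ (R p) λ w → IsUnit p w × EqR p (powR p w p) u

-- the element  x - y t^a  of R  (a taken mod p; for a ≢ 0 mod p)
linR : (p : ℕ) .{{_ : NonZero p}} → ℕ → ℕ → ℕ → R p
linR p x y a i =
  (if does (toℕ i ≟ 0) then x else 0)
  + (if does (toℕ i ≟ a % p) then (p ∸ y % p) else 0)

LinIndep : (p : ℕ) .{{_ : NonZero p}} (r : ℕ) → (Fin r → R p) → Set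
LinIndep p r v =
  ∀ (c : Fin r → ℕ) → IsPthPowerOfUnit p (prodPowR p r v c) → ∀ i → c i % p ≡ 0

-- dim_{Z/p} of the subspace of R^×/(R^×)^p spanned by the classes of the units
-- z_0,...,z_{m-1} is at least r: the span contains r linearly independent vectors
-- (each element of the span is the class of Π_k z_k^{a_k}).
DimSpanAtLeast : (p : ℕ) .{{_ : NonZero p}} (m : ℕ) → (Fin m → R p) → ℕ → Set
DimSpanAtLeast p m z r =
  Σ (Fin r → Fin m → ℕ) λ a → LinIndep p r (λ i → prodPowR p m z (a i))

mirimanoff : ℕ → ℕ → ℕ → ℕ
mirimanoff p k u = sum (map (λ j → j ^ (k ∸ 1) * u ^ j) (map suc (upTo (p ∸ 1))))

rp : (p : ℕ) .{{_ : NonZero p}} → ℕ → ℕ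
rp p u = length (filter (λ k → ¬? (mirimanoff p (2 * k + 1) u % p ≟ 0))
                        (map suc (upTo ((p ∸ 1) / 2))))

GeneratesUnits : (p : ℕ) .{{_ : NonZero p}} → ℕ → Set
GeneratesUnits p s = ∀ a → ¬ (a % p ≡ 0) → ∃ λ n → s ^ n % p ≡ a % p

-- For each exponent e, f ↦ ℒ e f, the e-th moment ∑ᵢ iᵉ [(t d/dt f) / f]ᵢ of the logarithmic
-- derivative, is a homomorphism R^× → Z/p killing p-th powers, i.e. a linear form on R^×/(R^×)^p.
-- On x - y t^b it takes the value -b^(e+1) τ(e), so on z_k = (x - y t^(A_k)) / (x - y t^(-A_k)),
-- A_k = s^k, and for e = 2K it gives -2 A_k^(2K+1) τ(2K), where τ(2K) = y^p M_{2K+1}(x/y).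
-- For every K with M_{2K+1}(x/y) ≠ 0 put V_K = ∏_k z_k^(A_k^(-2K-1)). The A_k^2 run over the cyclic
-- group of squares of order (p-1)/2, so by orthogonality of its characters ℒ_{2K′} V_K vanishes for
-- K′ ≠ K and equals -(p-1) τ(2K) ≠ 0 for K′ = K: the r_p(x/y) classes V_K are independent.
module Submission where

open import Defs
open import Data.Nat using (ℕ; zero; suc; _+_; _*_; _∸_; _^_; _≤_; _<_; _≟_; _<?_; z≤n; s≤s; z<s; s<s; s≤s⁻¹; pred)
open import Data.Nat using (NonZero; >-nonZero; >-nonZero⁻¹; ≢-nonZero; nonTrivial⇒n>1)
open import Data.Nat.Properties
open import Data.Nat.DivMod
open import Data.Nat.Divisibility using (m%n≡0⇒n∣m; n∣m⇒m%n≡0)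
open import Data.Nat.Primality using (Prime; euclidsLemma; prime⇒nonTrivial)
open import Data.Nat.ListAction using (sum)
open import Data.Nat.Tactic.RingSolver using (solve-∀)
open import Data.Fin using (Fin; toℕ; fromℕ<) renaming (zero to fzero; suc to fsuc)
open import Data.Fin.Properties using (toℕ<n; toℕ-fromℕ<; toℕ-injective; pigeonhole) renaming (suc-injective to Fin-suc-injective)
open import Data.List using (List; []; _∷_; map; foldr; allFin; tabulate; applyUpTo; upTo; filter; lookup)
open import Data.List.Properties using (map-tabulate; map-applyUpTo)
open import Data.List.Membership.Propositional.Properties using (∈-lookup)
open import Data.List.Relation.Unary.All as All using (All)
open import Data.List.Relation.Unary.AllPairs using (_∷_)
open import Data.List.Relation.Unary.All.Properties using (all-filter; filter⁺; applyUpTo⁺₁)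
open import Data.List.Relation.Unary.Unique.Propositional using (Unique)
import Data.List.Relation.Unary.Unique.Propositional.Properties as Unique
open import Data.Bool using (Bool; true; false; if_then_else_)
open import Data.Product using (∃; _,_; _×_; proj₁; proj₂)
open import Data.Sum using (_⊎_; inj₁; inj₂)
open import Data.Empty using (⊥; ⊥-elim)
open import Relation.Nullary using (¬_; yes; no; does; ¬?)
open import Relation.Nullary.Decidable using (dec-true; dec-false)
open import Relation.Unary using (Decidable)
open import Relation.Binary.PropositionalEquality
open import Function using (_∘_; _$_)
open import Algebra.Properties.CommutativeSemigroup +-commutativeSemigroup using () renaming (interchange to +-interchange)
open import Algebra.Properties.CommutativeSemigroup *-commutativeSemigroup using (x∙yz≈y∙xz)

m∸n≡1+[m∸1+n] : ∀ m n → n < m → m ∸ n ≡ suc (m ∸ suc n)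
m∸n≡1+[m∸1+n] (suc m) zero    _         = refl
m∸n≡1+[m∸1+n] (suc m) (suc n) (s<s n<m) = m∸n≡1+[m∸1+n] m n n<m

∑ : ℕ → (ℕ → ℕ) → ℕ
∑ zero    f = 0
∑ (suc n) f = f 0 + ∑ n (λ i → f (suc i))

module _ where
  open ≡-Reasoning

  ∑-cong : ∀ n {f g : ℕ → ℕ} → (∀ i → i < n → f i ≡ g i) → ∑ n f ≡ ∑ n g
  ∑-cong zero    h = refl
  ∑-cong (suc n) h = cong₂ _+_ (h 0 z<s) (∑-cong n (λ i i<n → h (suc i) (s<s i<n)))

  ∑-+ : ∀ n (f g : ℕ → ℕ) → ∑ n (λ i → f i + g i) ≡ ∑ n f + ∑ n g
  ∑-+ zero    f g = refl
  ∑-+ (suc n) f g = begin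
    f 0 + g 0 + ∑ n (λ i → f (suc i) + g (suc i))
      ≡⟨ cong (f 0 + g 0 +_) (∑-+ n (λ i → f (suc i)) (λ i → g (suc i))) ⟩
    f 0 + g 0 + (∑ n (λ i → f (suc i)) + ∑ n (λ i → g (suc i)))
      ≡⟨ +-interchange (f 0) (g 0) _ _ ⟩
    f 0 + ∑ n (λ i → f (suc i)) + (g 0 + ∑ n (λ i → g (suc i))) ∎

  ∑-*ˡ : ∀ n c (f : ℕ → ℕ) → ∑ n (λ i → c * f i) ≡ c * ∑ n f
  ∑-*ˡ zero    c f = sym (*-zeroʳ c)
  ∑-*ˡ (suc n) c f =
    trans (cong (c * f 0 +_) (∑-*ˡ n c (λ i → f (suc i)))) (sym (*-distribˡ-+ c (f 0) _))

  ∑-*ʳ : ∀ n c (f : ℕ → ℕ) → ∑ n (λ i → f i * c) ≡ ∑ n f * c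
  ∑-*ʳ n c f = trans (∑-cong n (λ i _ → *-comm (f i) c)) (trans (∑-*ˡ n c f) (*-comm c (∑ n f)))

  ∑-zero : ∀ n (f : ℕ → ℕ) → (∀ i → i < n → f i ≡ 0) → ∑ n f ≡ 0
  ∑-zero zero    f h = refl
  ∑-zero (suc n) f h = cong₂ _+_ (h 0 z<s) (∑-zero n _ (λ i i<n → h (suc i) (s<s i<n)))

  ∑-single : ∀ n (f : ℕ → ℕ) a → a < n → (∀ i → i < n → i ≢ a → f i ≡ 0) → ∑ n f ≡ f a
  ∑-single (suc n) f zero    _ h =
    trans (cong (f 0 +_) (∑-zero n _ (λ i i<n → h (suc i) (s<s i<n) (λ ())))) (+-identityʳ (f 0))
  ∑-single (suc n) f (suc a) (s<s a<n) h =
    trans (cong (_+ ∑ n (λ i → f (suc i))) (h 0 z<s (λ ())))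
          (∑-single n (λ i → f (suc i)) a a<n (λ i i<n i≢a → h (suc i) (s<s i<n) (i≢a ∘ suc-injective)))

  ∑-swap : ∀ n m (F : ℕ → ℕ → ℕ) → ∑ n (λ i → ∑ m (F i)) ≡ ∑ m (λ j → ∑ n (λ i → F i j))
  ∑-swap zero    m F = sym (∑-zero m _ (λ _ _ → refl))
  ∑-swap (suc n) m F = begin
    ∑ m (F 0) + ∑ n (λ i → ∑ m (F (suc i)))          ≡⟨ cong (∑ m (F 0) +_) (∑-swap n m (λ i → F (suc i))) ⟩
    ∑ m (F 0) + ∑ m (λ j → ∑ n (λ i → F (suc i) j)) ≡⟨ sym (∑-+ m (F 0) _) ⟩
    ∑ m (λ j → F 0 j + ∑ n (λ i → F (suc i) j))      ∎

  ∑-last : ∀ n (f : ℕ → ℕ) → ∑ (suc n) f ≡ ∑ n f + f n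
  ∑-last zero    f = +-comm (f 0) 0
  ∑-last (suc n) f = trans (cong (f 0 +_) (∑-last n (λ i → f (suc i)))) (sym (+-assoc (f 0) _ _))

  ∑-reverse : ∀ n (f : ℕ → ℕ) → ∑ n f ≡ ∑ n (λ i → f (n ∸ suc i))
  ∑-reverse zero    f = refl
  ∑-reverse (suc n) f = begin
    f 0 + ∑ n (λ i → f (suc i))                               ≡⟨ cong (f 0 +_) (∑-reverse n (λ i → f (suc i))) ⟩
    f 0 + ∑ n (λ i → f (suc (n ∸ suc i)))                     ≡⟨ +-comm (f 0) _ ⟩
    ∑ n (λ i → f (suc (n ∸ suc i))) + f 0
      ≡⟨ cong₂ _+_ (∑-cong n (λ i i<n → cong f (sym (+-∸-assoc 1 i<n)))) (cong f (sym (n∸n≡0 n))) ⟩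
    ∑ n (λ i → f (suc n ∸ suc i)) + f (suc n ∸ suc n)         ≡⟨ sym (∑-last n (λ i → f (suc n ∸ suc i))) ⟩
    ∑ (suc n) (λ i → f (suc n ∸ suc i))                       ∎

  ∑-rotate : ∀ n (F : ℕ → ℕ) → (∀ a → F (a + n) ≡ F a) → ∀ c → ∑ n (λ m → F (m + c)) ≡ ∑ n F
  ∑-rotate n F periodic zero    = ∑-cong n (λ m _ → cong F (+-identityʳ m))
  ∑-rotate n F periodic (suc c) = begin
    ∑ n (λ m → F (m + suc c))   ≡⟨ ∑-cong n (λ m _ → cong F (+-suc m c)) ⟩
    ∑ n (λ m → G (suc m))       ≡⟨ +-cancelʳ-≡ (G 0) _ _ rotated ⟩
    ∑ n G                       ≡⟨ ∑-rotate n F periodic c ⟩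
    ∑ n F                       ∎
    where
    G : ℕ → ℕ
    G m = F (m + c)
    rotated : ∑ n (λ m → G (suc m)) + G 0 ≡ ∑ n G + G 0
    rotated = begin
      ∑ n (λ m → G (suc m)) + G 0 ≡⟨ +-comm _ (G 0) ⟩
      ∑ (suc n) G                 ≡⟨ ∑-last n G ⟩
      ∑ n G + F (n + c)           ≡⟨ cong (λ t → ∑ n G + F t) (+-comm n c) ⟩
      ∑ n G + F (c + n)           ≡⟨ cong (∑ n G +_) (periodic c) ⟩
      ∑ n G + G 0                 ∎

  ∑-const-1 : ∀ n → ∑ n (λ _ → 1) ≡ n
  ∑-const-1 zero    = refl
  ∑-const-1 (suc n) = cong suc (∑-const-1 n)

  sumFin≡∑ : ∀ n (f : Fin n → ℕ) (g : ℕ → ℕ) → (∀ i → f i ≡ g (toℕ i)) → sumFin n f ≡ ∑ n g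
  sumFin≡∑ n f g f≗g = trans (cong sum (map-tabulate (λ i → i) f)) (sum-tabulate n f g f≗g)
    where
    sum-tabulate : ∀ n (f : Fin n → ℕ) (g : ℕ → ℕ) → (∀ i → f i ≡ g (toℕ i)) → sum (tabulate f) ≡ ∑ n g
    sum-tabulate zero    f g h = refl
    sum-tabulate (suc n) f g h = cong₂ _+_ (h fzero) (sum-tabulate n (λ i → f (fsuc i)) (λ i → g (suc i)) (λ i → h (fsuc i)))

  sum-applyUpTo≡∑ : ∀ n (f : ℕ → ℕ) → sum (applyUpTo f n) ≡ ∑ n f
  sum-applyUpTo≡∑ zero    f = refl
  sum-applyUpTo≡∑ (suc n) f = cong (f 0 +_) (sum-applyUpTo≡∑ n (λ i → f (suc i)))

module _ {A : Set} where

  sum-map-+ : ∀ (l : List A) F G → sum (map (λ k → F k + G k) l) ≡ sum (map F l) + sum (map G l)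
  sum-map-+ []      F G = refl
  sum-map-+ (k ∷ l) F G = trans (cong (F k + G k +_) (sum-map-+ l F G)) (+-interchange (F k) (G k) _ _)

  sum-map-*ˡ : ∀ (l : List A) c F → sum (map (λ k → c * F k) l) ≡ c * sum (map F l)
  sum-map-*ˡ []      c F = sym (*-zeroʳ c)
  sum-map-*ˡ (k ∷ l) c F = trans (cong (c * F k +_) (sum-map-*ˡ l c F)) (sym (*-distribˡ-+ c (F k) _))

  sum-map-0 : ∀ (l : List A) → sum (map (λ _ → 0) l) ≡ 0
  sum-map-0 []      = refl
  sum-map-0 (_ ∷ l) = sum-map-0 l

lookup-injective : ∀ {xs : List ℕ} → Unique xs → ∀ i j → lookup xs i ≡ lookup xs j → i ≡ j
lookup-injective (_ ∷ _)      fzero    fzero    _   = refl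
lookup-injective (x∉xs ∷ _)   fzero    (fsuc j) x≡y = ⊥-elim (All.lookup x∉xs (∈-lookup j) x≡y)
lookup-injective (x∉xs ∷ _)   (fsuc i) fzero    y≡x = ⊥-elim (All.lookup x∉xs (∈-lookup i) (sym y≡x))
lookup-injective (_ ∷ unique) (fsuc i) (fsuc j) eq  = cong fsuc (lookup-injective unique i j eq)

sumFin-suc : ∀ n (F : Fin (suc n) → ℕ) → sumFin (suc n) F ≡ F fzero + sumFin n (F ∘ fsuc)
sumFin-suc n F = cong (F fzero +_) (cong sum (trans (map-tabulate fsuc F) (sym (map-tabulate (λ i → i) (F ∘ fsuc)))))

^-distribʳ-* : ∀ m n o → (m * n) ^ o ≡ m ^ o * n ^ o
^-distribʳ-* m n zero    = refl
^-distribʳ-* m n (suc o) = trans (cong (m * n *_) (^-distribʳ-* m n o)) (interchange m n (m ^ o) (n ^ o))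
  where
  interchange : ∀ a b c d → a * b * (c * d) ≡ a * c * (b * d)
  interchange = solve-∀

δ : ℕ → ℕ → ℕ
δ a b = if does (a ≟ b) then 1 else 0

δ-≡ : ∀ {a b} → a ≡ b → δ a b ≡ 1
δ-≡ {a} {b} a≡b = cong (λ c → if c then 1 else 0) (dec-true (a ≟ b) a≡b)

δ-≢ : ∀ {a b} → a ≢ b → δ a b ≡ 0
δ-≢ {a} {b} a≢b = cong (λ c → if c then 1 else 0) (dec-false (a ≟ b) a≢b)

δ-sym : ∀ a b → δ a b ≡ δ b a
δ-sym a b with a ≟ b
... | yes a≡b = trans (δ-≡ a≡b) (sym (δ-≡ (sym a≡b)))
... | no  a≢b = trans (δ-≢ a≢b) (sym (δ-≢ (a≢b ∘ sym)))

δ-cong-⇔ : ∀ {a b c d} → (a ≡ b → c ≡ d) → (c ≡ d → a ≡ b) → δ a b ≡ δ c d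
δ-cong-⇔ {a} {b} to from with a ≟ b
... | yes a≡b = trans (δ-≡ a≡b) (sym (δ-≡ (to a≡b)))
... | no  a≢b = trans (δ-≢ a≢b) (sym (δ-≢ (λ c≡d → a≢b (from c≡d))))

if-x-0≡if-1-0*x : ∀ (c : Bool) x → (if c then x else 0) ≡ (if c then 1 else 0) * x
if-x-0≡if-1-0*x true  x = sym (+-identityʳ x)
if-x-0≡if-1-0*x false x = refl

∑-δ : ∀ n (u : ℕ → ℕ) t (G : ℕ → ℕ) i₀ → i₀ < n →
      (∀ i → i < n → u i ≡ t → i ≡ i₀) → u i₀ ≡ t →
      ∑ n (λ i → δ (u i) t * G i) ≡ G i₀
∑-δ n u t G i₀ i₀<n unique hit =
  trans (∑-single n _ i₀ i₀<n off) (trans (cong (_* G i₀) (δ-≡ hit)) (+-identityʳ (G i₀)))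
  where
  off : ∀ i → i < n → i ≢ i₀ → δ (u i) t * G i ≡ 0
  off i i<n i≢i₀ = cong (_* G i) (δ-≢ (λ e → i≢i₀ (unique i i<n e)))

module Congruence (p : ℕ) .{{_ : NonZero p}} where
  open ≡-Reasoning

  infix 4 _≈_
  _≈_ : ℕ → ℕ → Set
  a ≈ b = a % p ≡ b % p

  +-cong≈ : ∀ {a b c d} → a ≈ b → c ≈ d → a + c ≈ b + d
  +-cong≈ {a} {b} {c} {d} a≈b c≈d = begin
    (a + c) % p             ≡⟨ %-distribˡ-+ a c p ⟩
    (a % p + c % p) % p     ≡⟨ cong₂ (λ u v → (u + v) % p) a≈b c≈d ⟩
    (b % p + d % p) % p     ≡⟨ sym (%-distribˡ-+ b d p) ⟩
    (b + d) % p             ∎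

  *-cong≈ : ∀ {a b c d} → a ≈ b → c ≈ d → a * c ≈ b * d
  *-cong≈ {a} {b} {c} {d} a≈b c≈d = begin
    (a * c) % p             ≡⟨ %-distribˡ-* a c p ⟩
    (a % p * (c % p)) % p   ≡⟨ cong₂ (λ u v → (u * v) % p) a≈b c≈d ⟩
    (b % p * (d % p)) % p   ≡⟨ sym (%-distribˡ-* b d p) ⟩
    (b * d) % p             ∎

  +-congˡ≈ : ∀ {a b} c → a ≈ b → c + a ≈ c + b
  +-congˡ≈ c = +-cong≈ {c} {c} refl

  +-congʳ≈ : ∀ {a b} c → a ≈ b → a + c ≈ b + c
  +-congʳ≈ c a≈b = +-cong≈ a≈b (refl {x = c % p})

  *-congˡ≈ : ∀ {a b} c → a ≈ b → c * a ≈ c * b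
  *-congˡ≈ c = *-cong≈ {c} {c} refl

  *-congʳ≈ : ∀ {a b} c → a ≈ b → a * c ≈ b * c
  *-congʳ≈ c a≈b = *-cong≈ a≈b (refl {x = c % p})

  ^-cong≈ : ∀ {a b} n → a ≈ b → a ^ n ≈ b ^ n
  ^-cong≈ zero    a≈b = refl
  ^-cong≈ (suc n) a≈b = *-cong≈ a≈b (^-cong≈ n a≈b)

  ∑-cong≈ : ∀ n {f g : ℕ → ℕ} → (∀ i → i < n → f i ≈ g i) → ∑ n f ≈ ∑ n g
  ∑-cong≈ zero    h = refl
  ∑-cong≈ (suc n) h = +-cong≈ (h 0 z<s) (∑-cong≈ n (λ i i<n → h (suc i) (s<s i<n)))

  0%p≡0 : 0 % p ≡ 0
  0%p≡0 = m<n⇒m%n≡m (>-nonZero⁻¹ p)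

  ≡0⇒≈0 : ∀ {a} → a % p ≡ 0 → a ≈ 0
  ≡0⇒≈0 a%p≡0 = trans a%p≡0 (sym 0%p≡0)

  ≈0⇒≡0 : ∀ {a} → a ≈ 0 → a % p ≡ 0
  ≈0⇒≡0 a≈0 = trans a≈0 0%p≡0

  %≈ : ∀ a → a % p ≈ a
  %≈ a = m%n%n≡m%n a p

  p≈0 : p ≈ 0
  p≈0 = ≡0⇒≈0 (n%n≡0 p)

  *p≈0 : ∀ a → a * p ≈ 0
  *p≈0 a = ≡0⇒≈0 (m*n%n≡0 a p)

  +p≈ : ∀ a → a + p ≈ a
  +p≈ a = [m+n]%n≡m%n a p

  neg : ℕ → ℕ
  neg a = p ∸ a % p

  neg+≈0 : ∀ a → neg a + a ≈ 0
  neg+≈0 a = begin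
    (neg a + a) % p        ≡⟨ +-congˡ≈ (neg a) (sym (%≈ a)) ⟩
    (neg a + a % p) % p    ≡⟨ cong (_% p) (m∸n+n≡m (m%n≤n a p)) ⟩
    p % p                  ≡⟨ p≈0 ⟩
    0 % p                  ∎

  +neg≈0 : ∀ a → a + neg a ≈ 0
  +neg≈0 a = trans (cong (_% p) (+-comm a (neg a))) (neg+≈0 a)

  +-cancelʳ≈ : ∀ {a b} c → a + c ≈ b + c → a ≈ b
  +-cancelʳ≈ {a} {b} c a+c≈b+c = begin
    a % p                  ≡⟨ sym (+-identityʳ≈ a) ⟩
    (a + (c + neg c)) % p  ≡⟨ cong (_% p) (sym (+-assoc a c (neg c))) ⟩
    (a + c + neg c) % p    ≡⟨ +-congʳ≈ (neg c) a+c≈b+c ⟩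
    (b + c + neg c) % p    ≡⟨ cong (_% p) (+-assoc b c (neg c)) ⟩
    (b + (c + neg c)) % p  ≡⟨ +-identityʳ≈ b ⟩
    b % p                  ∎
    where
    +-identityʳ≈ : ∀ x → x + (c + neg c) ≈ x
    +-identityʳ≈ x = trans (+-congˡ≈ x (+neg≈0 c)) (cong (_% p) (+-identityʳ x))

  +-cancelˡ≈ : ∀ {a b} c → c + a ≈ c + b → a ≈ b
  +-cancelˡ≈ {a} {b} c c+a≈c+b =
    +-cancelʳ≈ c (trans (cong (_% p) (+-comm a c)) (trans c+a≈c+b (cong (_% p) (+-comm c b))))

  neg-unique : ∀ {a b c} → a + b ≈ 0 → c + b ≈ 0 → a ≈ c
  neg-unique {b = b} a+b≈0 c+b≈0 = +-cancelʳ≈ b (trans a+b≈0 (sym c+b≈0))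

  neg-cong : ∀ {a b} → a ≈ b → neg a ≡ neg b
  neg-cong a≈b = cong (p ∸_) a≈b

  neg-+p : ∀ a → neg (a + p) ≡ neg a
  neg-+p a = neg-cong (+p≈ a)

  neg-< : ∀ {a} → a < p → neg a ≡ p ∸ a
  neg-< a<p = cong (p ∸_) (m<n⇒m%n≡m a<p)

  suc[p∸1]≡p : suc (p ∸ 1) ≡ p
  suc[p∸1]≡p = m+[n∸m]≡n {1} (>-nonZero⁻¹ p)

  +neg0≈ : ∀ a → a + neg 0 ≈ a
  +neg0≈ a = trans (cong (λ t → (a + t) % p) (neg-< (>-nonZero⁻¹ p))) (+p≈ a)

  +neg+≈ : ∀ a b → a + neg b + b ≈ a
  +neg+≈ a b = begin
    (a + neg b + b) % p     ≡⟨ cong (_% p) (+-assoc a (neg b) b) ⟩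
    (a + (neg b + b)) % p   ≡⟨ +-congˡ≈ a (neg+≈0 b) ⟩
    (a + 0) % p             ≡⟨ cong (_% p) (+-identityʳ a) ⟩
    a % p                   ∎

  +[+neg]≈ : ∀ a b → b + (a + neg b) ≈ a
  +[+neg]≈ a b = trans (cong (_% p) (+-comm b (a + neg b))) (+neg+≈ a b)

  +≈0∧≈0⇒≈0ʳ : ∀ {a c} → a + c ≈ 0 → a ≈ 0 → c ≈ 0
  +≈0∧≈0⇒≈0ʳ {c = c} a+c≈0 a≈0 = trans (sym (+-congʳ≈ c a≈0)) a+c≈0

  +≈0∧≈0⇒≈0ˡ : ∀ {a c} → a + c ≈ 0 → c ≈ 0 → a ≈ 0
  +≈0∧≈0⇒≈0ˡ {a} a+c≈0 c≈0 = trans (cong (_% p) (sym (+-identityʳ a))) (trans (sym (+-congˡ≈ a c≈0)) a+c≈0)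

  sum-map-cong≈ : ∀ {A : Set} (l : List A) {F G : A → ℕ} → (∀ k → F k ≈ G k) → sum (map F l) ≈ sum (map G l)
  sum-map-cong≈ []      F≈G = refl
  sum-map-cong≈ (k ∷ l) F≈G = +-cong≈ (F≈G k) (sum-map-cong≈ l F≈G)

  sumFin-single≈ : ∀ n (F : Fin n → ℕ) j → (∀ i → i ≢ j → F i ≈ 0) → sumFin n F ≈ F j
  sumFin-single≈ (suc n) F fzero off = begin
    sumFin (suc n) F % p                  ≡⟨ cong (_% p) (sumFin-suc n F) ⟩
    (F fzero + sumFin n (F ∘ fsuc)) % p   ≡⟨ +-congˡ≈ (F fzero) (sumFin-zero≈ n (F ∘ fsuc) (λ i → off (fsuc i) (λ ()))) ⟩
    (F fzero + 0) % p                     ≡⟨ cong (_% p) (+-identityʳ (F fzero)) ⟩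
    F fzero % p                           ∎
    where
    sumFin-zero≈ : ∀ n (F : Fin n → ℕ) → (∀ i → F i ≈ 0) → sumFin n F ≈ 0
    sumFin-zero≈ zero    F F≈0 = refl
    sumFin-zero≈ (suc n) F F≈0 =
      trans (cong (_% p) (sumFin-suc n F)) (+-cong≈ (F≈0 fzero) (sumFin-zero≈ n (F ∘ fsuc) (F≈0 ∘ fsuc)))
  sumFin-single≈ (suc n) F (fsuc j) off = begin
    sumFin (suc n) F % p                  ≡⟨ cong (_% p) (sumFin-suc n F) ⟩
    (F fzero + sumFin n (F ∘ fsuc)) % p   ≡⟨ +-congʳ≈ (sumFin n (F ∘ fsuc)) (off fzero (λ ())) ⟩
    (0 + sumFin n (F ∘ fsuc)) % p
      ≡⟨ sumFin-single≈ n (F ∘ fsuc) j (λ i i≢j → off (fsuc i) (i≢j ∘ Fin-suc-injective)) ⟩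
    F (fsuc j) % p                        ∎

  ∑-δ-at : ∀ c (F : ℕ → ℕ) → c < p → ∑ p (λ i → δ (i % p) c * F i) ≡ F c
  ∑-δ-at c F c<p = ∑-δ p (_% p) c F c c<p (λ i i<p i%p≡c → trans (sym (m<n⇒m%n≡m i<p)) i%p≡c) (m<n⇒m%n≡m c<p)

  ∑-telescope≈ : ∀ m (h u v : ℕ → ℕ) → (∀ j → j < m → u (suc j) + v j ≈ 0) →
                 ∑ (suc m) (λ j → h j * u j) + ∑ (suc m) (λ j → h (suc j) * v j) ≈ h 0 * u 0 + h (suc m) * v m
  ∑-telescope≈ zero    h u v _ = cong (_% p) (rearrange (h 0 * u 0) (h 1 * v 0))
    where
    rearrange : ∀ a b → a + 0 + (b + 0) ≡ a + b
    rearrange = solve-∀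
  ∑-telescope≈ (suc m) h u v cancels = begin
    (∑ (2 + m) (λ j → h j * u j) + ∑ (2 + m) (λ j → h (suc j) * v j)) % p
      ≡⟨ cong₂ (λ a b → (a + b) % p) (∑-last (suc m) (λ j → h j * u j)) (∑-last (suc m) (λ j → h (suc j) * v j)) ⟩
    (A + H * u (suc m) + (B + b)) % p
      ≡⟨ cong (_% p) (regroup A B (H * u (suc m)) b) ⟩
    (A + B + H * u (suc m) + b) % p
      ≡⟨ +-congʳ≈ b (+-congʳ≈ (H * u (suc m)) (∑-telescope≈ m h u v (λ j j<m → cancels j (m<n⇒m<1+n j<m)))) ⟩
    (h 0 * u 0 + H * v m + H * u (suc m) + b) % p
      ≡⟨ cong (_% p) (factor (h 0 * u 0) H (v m) (u (suc m)) b) ⟩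
    (h 0 * u 0 + H * (u (suc m) + v m) + b) % p
      ≡⟨ +-congʳ≈ b (+-congˡ≈ (h 0 * u 0) (*-congˡ≈ H (cancels m ≤-refl))) ⟩
    (h 0 * u 0 + H * 0 + b) % p
      ≡⟨ cong (λ t → (h 0 * u 0 + t + b) % p) (*-zeroʳ H) ⟩
    (h 0 * u 0 + 0 + b) % p
      ≡⟨ cong (λ t → (t + b) % p) (+-identityʳ (h 0 * u 0)) ⟩
    (h 0 * u 0 + b) % p ∎
    where
    A B H b : ℕ
    A = ∑ (suc m) (λ j → h j * u j)
    B = ∑ (suc m) (λ j → h (suc j) * v j)
    H = h (suc m)
    b = h (2 + m) * v (suc m)
    regroup : ∀ A B c d → A + c + (B + d) ≡ A + B + c + d
    regroup = solve-∀
    factor : ∀ a H v u b → a + H * v + H * u + b ≡ a + H * (u + v) + b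
    factor = solve-∀

  ^-%≈ : ∀ a e .{{_ : NonZero e}} n → a ^ e ≈ 1 → a ^ n ≈ a ^ (n % e)
  ^-%≈ a e n aᵉ≈1 = begin
    a ^ n % p                          ≡⟨ cong (λ t → a ^ t % p) (m≡m%n+[m/n]*n n e) ⟩
    a ^ (n % e + n / e * e) % p        ≡⟨ cong (_% p) (^-distribˡ-+-* a (n % e) (n / e * e)) ⟩
    (a ^ (n % e) * a ^ (n / e * e)) % p
      ≡⟨ cong (λ t → (a ^ (n % e) * t) % p) (trans (cong (a ^_) (*-comm (n / e) e)) (sym (^-*-assoc a e (n / e)))) ⟩
    (a ^ (n % e) * (a ^ e) ^ (n / e)) % p ≡⟨ *-congˡ≈ (a ^ (n % e)) (^-cong≈ (n / e) aᵉ≈1) ⟩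
    (a ^ (n % e) * 1 ^ (n / e)) % p    ≡⟨ cong (λ t → (a ^ (n % e) * t) % p) (^-zeroˡ (n / e)) ⟩
    (a ^ (n % e) * 1) % p              ≡⟨ cong (_% p) (*-identityʳ _) ⟩
    a ^ (n % e) % p                    ∎

  [p∸a]²≈a² : ∀ a → a ≤ p → (p ∸ a) * (p ∸ a) ≈ a * a
  [p∸a]²≈a² a a≤p = neg-unique {b = a * (p ∸ a)} [p∸a]²+a[p∸a]≈0 a²+a[p∸a]≈0
    where
    [p∸a]²+a[p∸a]≈0 : (p ∸ a) * (p ∸ a) + a * (p ∸ a) ≈ 0
    [p∸a]²+a[p∸a]≈0 = trans (cong (_% p) (trans (sym (*-distribʳ-+ (p ∸ a) (p ∸ a) a))
                                             (trans (cong (_* (p ∸ a)) (m∸n+n≡m a≤p)) (*-comm p (p ∸ a)))))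
                            (*p≈0 (p ∸ a))
    a²+a[p∸a]≈0 : a * a + a * (p ∸ a) ≈ 0
    a²+a[p∸a]≈0 = trans (cong (_% p) (trans (sym (*-distribˡ-+ a a (p ∸ a))) (cong (a *_) (m+[n∸m]≡n a≤p))))
                        (*p≈0 a)

  [p∸a]^even≈a^even : ∀ a k → a ≤ p → (p ∸ a) ^ (2 * k) ≈ a ^ (2 * k)
  [p∸a]^even≈a^even a k a≤p = begin
    (p ∸ a) ^ (2 * k) % p            ≡⟨ cong (_% p) (sym (^-*-assoc (p ∸ a) 2 k)) ⟩
    ((p ∸ a) ^ 2) ^ k % p            ≡⟨ cong (λ t → (t ^ k) % p) (cong ((p ∸ a) *_) (*-identityʳ (p ∸ a))) ⟩
    ((p ∸ a) * (p ∸ a)) ^ k % p      ≡⟨ ^-cong≈ k ([p∸a]²≈a² a a≤p) ⟩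
    (a * a) ^ k % p                  ≡⟨ cong (λ t → (t ^ k) % p) (cong (a *_) (sym (*-identityʳ a))) ⟩
    (a ^ 2) ^ k % p                  ≡⟨ cong (_% p) (^-*-assoc a 2 k) ⟩
    a ^ (2 * k) % p                  ∎

  neg^odd+^odd≈0 : ∀ a k → neg a ^ suc (2 * k) + a ^ suc (2 * k) ≈ 0
  neg^odd+^odd≈0 a k = begin
    (neg a * neg a ^ (2 * k) + a * a ^ (2 * k)) % p
      ≡⟨ +-cong≈ (*-congˡ≈ (neg a) ([p∸a]^even≈a^even (a % p) k (m%n≤n a p))) (*-congʳ≈ (a ^ (2 * k)) (sym (%≈ a))) ⟩
    (neg a * (a % p) ^ (2 * k) + a % p * a ^ (2 * k)) % p
      ≡⟨ +-congˡ≈ (neg a * (a % p) ^ (2 * k)) (*-congˡ≈ (a % p) (^-cong≈ (2 * k) (sym (%≈ a)))) ⟩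
    (neg a * (a % p) ^ (2 * k) + a % p * (a % p) ^ (2 * k)) % p
      ≡⟨ cong (_% p) (sym (*-distribʳ-+ ((a % p) ^ (2 * k)) (neg a) (a % p))) ⟩
    ((neg a + a % p) * (a % p) ^ (2 * k)) % p
      ≡⟨ cong (λ t → (t * (a % p) ^ (2 * k)) % p) (m∸n+n≡m (m%n≤n a p)) ⟩
    (p * (a % p) ^ (2 * k)) % p
      ≡⟨ cong (_% p) (*-comm p ((a % p) ^ (2 * k))) ⟩
    ((a % p) ^ (2 * k) * p) % p
      ≡⟨ *p≈0 ((a % p) ^ (2 * k)) ⟩
    0 % p ∎

  <p-≈-injective : ∀ {a b} → a < p → b < p → a ≈ b → a ≡ b
  <p-≈-injective a<p b<p a≈b = trans (sym (m<n⇒m%n≡m a<p)) (trans a≈b (m<n⇒m%n≡m b<p))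

  <p⇒≉0 : ∀ {a} → 0 < a → a < p → ¬ (a ≈ 0)
  <p⇒≉0 {a} 0<a a<p a≈0 = <-irrefl (sym (trans (sym (m<n⇒m%n≡m a<p)) (≈0⇒≡0 a≈0))) 0<a

  ≈-injective-on-[1,p] : ∀ {a b} → 0 < a → a ≤ p → 0 < b → b ≤ p → a ≈ b → a ≡ b
  ≈-injective-on-[1,p] {a} {b} 0<a a≤p 0<b b≤p a≈b with m≤n⇒m<n∨m≡n a≤p | m≤n⇒m<n∨m≡n b≤p
  ... | inj₂ a≡p | inj₂ b≡p = trans a≡p (sym b≡p)
  ... | inj₁ a<p | inj₁ b<p = <p-≈-injective a<p b<p a≈b
  ... | inj₁ a<p | inj₂ b≡p = ⊥-elim (<p⇒≉0 0<a a<p (trans a≈b (trans (cong (_% p) b≡p) p≈0)))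
  ... | inj₂ a≡p | inj₁ b<p = ⊥-elim (<p⇒≉0 0<b b<p (trans (sym a≈b) (trans (cong (_% p) a≡p) p≈0)))

  module PrimeModulus (pr : Prime p) where

    euclid≈ : ∀ a b → a * b ≈ 0 → a ≈ 0 ⊎ b ≈ 0
    euclid≈ a b ab≈0 with euclidsLemma a b pr (m%n≡0⇒n∣m (a * b) p (≈0⇒≡0 ab≈0))
    ... | inj₁ p∣a = inj₁ (≡0⇒≈0 (n∣m⇒m%n≡0 a p p∣a))
    ... | inj₂ p∣b = inj₂ (≡0⇒≈0 (n∣m⇒m%n≡0 b p p∣b))

    1<p : 1 < p
    1<p = nonTrivial⇒n>1 p {{prime⇒nonTrivial pr}}

    *-≉0 : ∀ {a b} → ¬ (a ≈ 0) → ¬ (b ≈ 0) → ¬ (a * b ≈ 0)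
    *-≉0 {a} {b} a≉0 b≉0 ab≈0 with euclid≈ a b ab≈0
    ... | inj₁ a≈0 = a≉0 a≈0
    ... | inj₂ b≈0 = b≉0 b≈0

    ^-≉0 : ∀ {a} n → ¬ (a ≈ 0) → ¬ (a ^ n ≈ 0)
    ^-≉0 zero    a≉0 = <p⇒≉0 z<s 1<p
    ^-≉0 (suc n) a≉0 = *-≉0 a≉0 (^-≉0 n a≉0)

    *-cancelˡ≈ : ∀ {a b c} → ¬ (a ≈ 0) → a * b ≈ a * c → b ≈ c
    *-cancelˡ≈ {a} {b} {c} a≉0 ab≈ac with euclid≈ a (b + neg c) a[b-c]≈0
      where
      a[b-c]≈0 : a * (b + neg c) ≈ 0
      a[b-c]≈0 = begin
        (a * (b + neg c)) % p        ≡⟨ cong (_% p) (*-distribˡ-+ a b (neg c)) ⟩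
        (a * b + a * neg c) % p      ≡⟨ +-congʳ≈ (a * neg c) ab≈ac ⟩
        (a * c + a * neg c) % p      ≡⟨ cong (_% p) (sym (*-distribˡ-+ a c (neg c))) ⟩
        (a * (c + neg c)) % p        ≡⟨ *-congˡ≈ a (+neg≈0 c) ⟩
        (a * 0) % p                  ≡⟨ cong (_% p) (*-zeroʳ a) ⟩
        0 % p                        ∎
    ... | inj₁ a≈0   = ⊥-elim (a≉0 a≈0)
    ... | inj₂ b-c≈0 = neg-unique b-c≈0 (+neg≈0 c)

    ∑-geometric-1 : ∀ m q → q ≈ 1 → ∑ m (λ k → q ^ suc k) ≈ m
    ∑-geometric-1 m q q≈1 = trans (∑-cong≈ m (λ k _ → trans (^-cong≈ (suc k) q≈1) (cong (_% p) (^-zeroˡ (suc k)))))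
                                  (cong (_% p) (∑-const-1 m))

    -- q ∑ qᵏ⁺¹ = ∑ qᵏ⁺¹ because qᵐ = 1, so the sum vanishes unless q = 1.
    ∑-geometric≈0 : ∀ m q → q ^ m ≈ 1 → ¬ (q ≈ 1) → ∑ m (λ k → q ^ suc k) ≈ 0
    ∑-geometric≈0 m q qᵐ≈1 q≉1 with ∑ m (λ k → q ^ suc k) % p ≟ 0 % p
    ... | yes G≈0 = G≈0
    ... | no  G≉0 = ⊥-elim (q≉1 (*-cancelˡ≈ G≉0 Gq≈G1))
      where
      G : ℕ
      G = ∑ m (λ k → q ^ suc k)
      shifted : q * G + q * 1 ≡ G + q * q ^ m
      shifted = trans (cong (_+ q * 1) (sym (∑-*ˡ m q (λ k → q ^ suc k))))
                      (trans (+-comm _ (q * 1)) (∑-last m (λ k → q ^ suc k)))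
      qG≈G : q * G ≈ G
      qG≈G = +-cancelʳ≈ (q * 1) (trans (cong (_% p) shifted) (+-congˡ≈ G (*-congˡ≈ q qᵐ≈1)))
      Gq≈G1 : G * q ≈ G * 1
      Gq≈G1 = trans (cong (_% p) (*-comm G q)) (trans qG≈G (cong (_% p) (sym (*-identityʳ G))))

module GroupRing (p : ℕ) .{{_ : NonZero p}} where
  open Congruence p public
  open ≡-Reasoning

  0<p : 0 < p
  0<p = >-nonZero⁻¹ p

  toℕ-ix : ∀ n → toℕ (ix p n) ≡ n % p
  toℕ-ix n = toℕ-fromℕ< (m%n<n n p)

  ix-toℕ : ∀ (i : Fin p) → ix p (toℕ i) ≡ i
  ix-toℕ i = toℕ-injective (trans (toℕ-ix (toℕ i)) (m<n⇒m%n≡m (toℕ<n i)))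

  ix-cong : ∀ {n m} → n ≈ m → ix p n ≡ ix p m
  ix-cong n≈m = toℕ-injective (trans (toℕ-ix _) (trans n≈m (sym (toℕ-ix _))))

  infixl 20 _⟨_⟩
  _⟨_⟩ : R p → ℕ → ℕ
  f ⟨ n ⟩ = f (ix p n)

  ⟨toℕ⟩ : ∀ (f : R p) i → f ⟨ toℕ i ⟩ ≡ f i
  ⟨toℕ⟩ f i = cong f (ix-toℕ i)

  ⟨⟩-cong : ∀ (f : R p) {n m} → n ≈ m → f ⟨ n ⟩ ≡ f ⟨ m ⟩
  ⟨⟩-cong f n≈m = cong f (ix-cong n≈m)

  infix 4 _≋_
  record _≋_ (f g : R p) : Set where
    constructor mk≋
    field get : EqR p f g
  open _≋_ public

  ≋-refl : ∀ {f} → f ≋ f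
  ≋-refl = mk≋ (λ i → refl)

  ≋-sym : ∀ {f g} → f ≋ g → g ≋ f
  ≋-sym f≋g = mk≋ (λ i → sym (get f≋g i))

  ≋-trans : ∀ {f g h} → f ≋ g → g ≋ h → f ≋ h
  ≋-trans f≋g g≋h = mk≋ (λ i → trans (get f≋g i) (get g≋h i))

  ≋⇒⟨⟩≈ : ∀ {f g} → f ≋ g → ∀ n → f ⟨ n ⟩ ≈ g ⟨ n ⟩
  ≋⇒⟨⟩≈ f≋g n = get f≋g (ix p n)

  ⟨⟩≈⇒≋ : ∀ {f g} → (∀ n → n < p → f ⟨ n ⟩ ≈ g ⟨ n ⟩) → f ≋ g
  ⟨⟩≈⇒≋ {f} {g} h = mk≋ (λ i → subst₂ _≈_ (⟨toℕ⟩ f i) (⟨toℕ⟩ g i) (h (toℕ i) (toℕ<n i)))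

  ⟨⟩≡⇒≋ : ∀ {f g} → (∀ n → f ⟨ n ⟩ ≡ g ⟨ n ⟩) → f ≋ g
  ⟨⟩≡⇒≋ h = ⟨⟩≈⇒≋ (λ n _ → cong (_% p) (h n))

  infixl 7 _·_
  infixl 6 _⊕_
  -- Opaque, so that unification never unfolds the convolution sums.
  opaque
    _·_ : R p → R p → R p
    f · g = mulR p f g

    ·-def : ∀ f g k → (f · g) k ≡ mulR p f g k
    ·-def f g k = refl

    _⊕_ : R p → R p → R p
    (f ⊕ g) i = f i + g i

    ⊕-def : ∀ f g k → (f ⊕ g) k ≡ f k + g k
    ⊕-def f g k = refl

    -- The derivation t d/dt.
    ∂ : R p → R p
    ∂ f i = toℕ i * f i

    ∂-def : ∀ f k → ∂ f k ≡ toℕ k * f k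
    ∂-def f k = refl

  𝟙 : R p
  𝟙 = oneR p

  𝟘 : R p
  𝟘 i = 0

  mulR≋· : ∀ f g → mulR p f g ≋ f · g
  mulR≋· f g = mk≋ (λ k → cong (_% p) (sym (·-def f g k)))

  ⊕-⟨⟩ : ∀ f g n → (f ⊕ g) ⟨ n ⟩ ≡ f ⟨ n ⟩ + g ⟨ n ⟩
  ⊕-⟨⟩ f g n = ⊕-def f g (ix p n)

  ∂-⟨⟩ : ∀ f n → ∂ f ⟨ n ⟩ ≡ n % p * f ⟨ n ⟩
  ∂-⟨⟩ f n = trans (∂-def f (ix p n)) (cong (_* f ⟨ n ⟩) (toℕ-ix n))

  𝟙-⟨⟩ : ∀ i → 𝟙 ⟨ i ⟩ ≡ δ (i % p) 0
  𝟙-⟨⟩ i = cong (λ t → δ t 0) (toℕ-ix i)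

  ·-⟨⟩ : ∀ f g n → (f · g) ⟨ n ⟩ ≡ ∑ p (λ i → f ⟨ i ⟩ * g ⟨ n + neg i ⟩)
  ·-⟨⟩ f g n = begin
    (f · g) ⟨ n ⟩
      ≡⟨ ·-def f g (ix p n) ⟩
    mulR p f g (ix p n)
      ≡⟨ sumFin≡∑ p _ _ (λ i → cong (_* g (ix p (toℕ (ix p n) + p ∸ toℕ i))) (sym (⟨toℕ⟩ f i))) ⟩
    ∑ p (λ i → f ⟨ i ⟩ * g ⟨ toℕ (ix p n) + p ∸ i ⟩)
      ≡⟨ ∑-cong p (λ i i<p → cong (f ⟨ i ⟩ *_) (⟨⟩-cong g (index≈ i i<p))) ⟩
    ∑ p (λ i → f ⟨ i ⟩ * g ⟨ n + neg i ⟩) ∎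
    where
    index≈ : ∀ i → i < p → toℕ (ix p n) + p ∸ i ≈ n + neg i
    index≈ i i<p = begin
      (toℕ (ix p n) + p ∸ i) % p   ≡⟨ cong (λ t → (t + p ∸ i) % p) (toℕ-ix n) ⟩
      (n % p + p ∸ i) % p          ≡⟨ cong (_% p) (+-∸-assoc (n % p) (<⇒≤ i<p)) ⟩
      (n % p + (p ∸ i)) % p        ≡⟨ +-congʳ≈ (p ∸ i) (%≈ n) ⟩
      (n + (p ∸ i)) % p            ≡⟨ cong (λ t → (n + t) % p) (sym (neg-< i<p)) ⟩
      (n + neg i) % p              ∎

  ∑-δ-shift : ∀ (g : R p) n i →
              ∑ p (λ j → δ ((i + j) % p) (n % p) * g ⟨ j ⟩) ≡ g ⟨ n + neg i ⟩
  ∑-δ-shift g n i =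
    trans (∑-δ p (λ j → (i + j) % p) (n % p) (λ j → g ⟨ j ⟩) ((n + neg i) % p) (m%n<n _ p) unique hit)
          (⟨⟩-cong g (%≈ (n + neg i)))
    where
    i+[n-i]≈n : i + (n + neg i) ≈ n
    i+[n-i]≈n = +[+neg]≈ n i
    hit : (i + (n + neg i) % p) % p ≡ n % p
    hit = trans (+-congˡ≈ i (%≈ (n + neg i))) i+[n-i]≈n
    unique : ∀ j → j < p → (i + j) % p ≡ n % p → j ≡ (n + neg i) % p
    unique j j<p i+j≈n = trans (sym (m<n⇒m%n≡m j<p)) (+-cancelˡ≈ i (trans i+j≈n (sym i+[n-i]≈n)))

  ·-⟨⟩-symmetric : ∀ f g n →
    (f · g) ⟨ n ⟩ ≡ ∑ p (λ i → ∑ p (λ j → δ ((i + j) % p) (n % p) * (f ⟨ i ⟩ * g ⟨ j ⟩)))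
  ·-⟨⟩-symmetric f g n = trans (·-⟨⟩ f g n) (∑-cong p (λ i _ → sym (begin
    ∑ p (λ j → δ ((i + j) % p) (n % p) * (f ⟨ i ⟩ * g ⟨ j ⟩))
      ≡⟨ ∑-cong p (λ j _ → x∙yz≈y∙xz (δ ((i + j) % p) (n % p)) (f ⟨ i ⟩) (g ⟨ j ⟩)) ⟩
    ∑ p (λ j → f ⟨ i ⟩ * (δ ((i + j) % p) (n % p) * g ⟨ j ⟩))
      ≡⟨ ∑-*ˡ p (f ⟨ i ⟩) _ ⟩
    f ⟨ i ⟩ * ∑ p (λ j → δ ((i + j) % p) (n % p) * g ⟨ j ⟩)
      ≡⟨ cong (f ⟨ i ⟩ *_) (∑-δ-shift g n i) ⟩
    f ⟨ i ⟩ * g ⟨ n + neg i ⟩ ∎)))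

  ·-comm : ∀ f g → f · g ≋ g · f
  ·-comm f g = ⟨⟩≡⇒≋ λ n → begin
    (f · g) ⟨ n ⟩
      ≡⟨ ·-⟨⟩-symmetric f g n ⟩
    ∑ p (λ i → ∑ p (λ j → δ ((i + j) % p) (n % p) * (f ⟨ i ⟩ * g ⟨ j ⟩)))
      ≡⟨ ∑-swap p p _ ⟩
    ∑ p (λ j → ∑ p (λ i → δ ((i + j) % p) (n % p) * (f ⟨ i ⟩ * g ⟨ j ⟩)))
      ≡⟨ ∑-cong p (λ j _ → ∑-cong p (λ i _ →
           cong₂ _*_ (cong (λ t → δ (t % p) (n % p)) (+-comm i j)) (*-comm (f ⟨ i ⟩) (g ⟨ j ⟩)))) ⟩
    ∑ p (λ j → ∑ p (λ i → δ ((j + i) % p) (n % p) * (g ⟨ j ⟩ * f ⟨ i ⟩)))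
      ≡⟨ sym (·-⟨⟩-symmetric g f n) ⟩
    (g · f) ⟨ n ⟩ ∎

  ∑-convolution-shift : ∀ (g h : R p) n i →
    ∑ p (λ m → g ⟨ m + neg i ⟩ * h ⟨ n + neg m ⟩) ≡ ∑ p (λ j → g ⟨ j ⟩ * h ⟨ n + neg i + neg j ⟩)
  ∑-convolution-shift g h n i = begin
    ∑ p (λ m → g ⟨ m + neg i ⟩ * h ⟨ n + neg m ⟩)
      ≡⟨ ∑-cong p (λ m _ → cong (g ⟨ m + neg i ⟩ *_) (⟨⟩-cong h (index≈ m))) ⟩
    ∑ p (λ m → F (m + neg i))                      ≡⟨ ∑-rotate p F periodic (neg i) ⟩
    ∑ p F                                          ∎
    where
    F : ℕ → ℕ
    F j = g ⟨ j ⟩ * h ⟨ n + neg i + neg j ⟩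
    periodic : ∀ a → F (a + p) ≡ F a
    periodic a = cong₂ _*_ (⟨⟩-cong g (+p≈ a)) (cong (λ t → h ⟨ n + neg i + t ⟩) (neg-+p a))
    index≈ : ∀ m → n + neg m ≈ n + neg i + neg (m + neg i)
    index≈ m = +-cancelʳ≈ m (begin
      (n + neg m + m) % p                             ≡⟨ +neg+≈ n m ⟩
      n % p                                           ≡⟨ sym (+neg+≈ n (m + neg i)) ⟩
      (n + neg (m + neg i) + (m + neg i)) % p         ≡⟨ cong (_% p) (rearrange n (neg (m + neg i)) m (neg i)) ⟩
      (n + neg i + neg (m + neg i) + m) % p           ∎)
      where
      rearrange : ∀ a b c d → a + b + (c + d) ≡ a + d + b + c
      rearrange = solve-∀

  ·-assoc : ∀ f g h → f · g · h ≋ f · (g · h)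
  ·-assoc f g h = ⟨⟩≡⇒≋ λ n → begin
    (f · g · h) ⟨ n ⟩
      ≡⟨ ·-⟨⟩ (f · g) h n ⟩
    ∑ p (λ m → (f · g) ⟨ m ⟩ * h ⟨ n + neg m ⟩)
      ≡⟨ ∑-cong p (λ m _ → cong (_* h ⟨ n + neg m ⟩) (·-⟨⟩ f g m)) ⟩
    ∑ p (λ m → ∑ p (λ i → f ⟨ i ⟩ * g ⟨ m + neg i ⟩) * h ⟨ n + neg m ⟩)
      ≡⟨ ∑-cong p (λ m _ → trans (sym (∑-*ʳ p (h ⟨ n + neg m ⟩) _)) (∑-cong p (λ i _ → *-assoc (f ⟨ i ⟩) _ _))) ⟩
    ∑ p (λ m → ∑ p (λ i → f ⟨ i ⟩ * (g ⟨ m + neg i ⟩ * h ⟨ n + neg m ⟩)))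
      ≡⟨ ∑-swap p p _ ⟩
    ∑ p (λ i → ∑ p (λ m → f ⟨ i ⟩ * (g ⟨ m + neg i ⟩ * h ⟨ n + neg m ⟩)))
      ≡⟨ ∑-cong p (λ i _ → trans (∑-*ˡ p (f ⟨ i ⟩) _) (cong (f ⟨ i ⟩ *_) (∑-convolution-shift g h n i))) ⟩
    ∑ p (λ i → f ⟨ i ⟩ * ∑ p (λ j → g ⟨ j ⟩ * h ⟨ n + neg i + neg j ⟩))
      ≡⟨ ∑-cong p (λ i _ → cong (f ⟨ i ⟩ *_) (sym (·-⟨⟩ g h (n + neg i)))) ⟩
    ∑ p (λ i → f ⟨ i ⟩ * (g · h) ⟨ n + neg i ⟩)
      ≡⟨ sym (·-⟨⟩ f (g · h) n) ⟩
    (f · (g · h)) ⟨ n ⟩ ∎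

  ·-cong : ∀ {f f′ g g′} → f ≋ f′ → g ≋ g′ → f · g ≋ f′ · g′
  ·-cong {f} {f′} {g} {g′} f≋f′ g≋g′ = ⟨⟩≈⇒≋ λ n _ → begin
    (f · g) ⟨ n ⟩ % p                                ≡⟨ cong (_% p) (·-⟨⟩ f g n) ⟩
    ∑ p (λ i → f ⟨ i ⟩ * g ⟨ n + neg i ⟩) % p
      ≡⟨ ∑-cong≈ p (λ i _ → *-cong≈ (≋⇒⟨⟩≈ f≋f′ i) (≋⇒⟨⟩≈ g≋g′ (n + neg i))) ⟩
    ∑ p (λ i → f′ ⟨ i ⟩ * g′ ⟨ n + neg i ⟩) % p      ≡⟨ cong (_% p) (sym (·-⟨⟩ f′ g′ n)) ⟩
    (f′ · g′) ⟨ n ⟩ % p                              ∎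

  ·-congˡ : ∀ f {g g′} → g ≋ g′ → f · g ≋ f · g′
  ·-congˡ f = ·-cong (≋-refl {f})

  ·-congʳ : ∀ {f f′} g → f ≋ f′ → f · g ≋ f′ · g
  ·-congʳ g f≋f′ = ·-cong f≋f′ (≋-refl {g})

  ⊕-cong : ∀ {f f′ g g′} → f ≋ f′ → g ≋ g′ → f ⊕ g ≋ f′ ⊕ g′
  ⊕-cong {f} {f′} {g} {g′} f≋f′ g≋g′ = mk≋ λ i →
    trans (cong (_% p) (⊕-def f g i))
          (trans (+-cong≈ (get f≋f′ i) (get g≋g′ i)) (cong (_% p) (sym (⊕-def f′ g′ i))))

  ·-identityˡ : ∀ g → 𝟙 · g ≋ g
  ·-identityˡ g = ⟨⟩≡⇒≋ λ n → begin
    (𝟙 · g) ⟨ n ⟩                             ≡⟨ ·-⟨⟩ 𝟙 g n ⟩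
    ∑ p (λ i → 𝟙 ⟨ i ⟩ * g ⟨ n + neg i ⟩)      ≡⟨ ∑-single p _ 0 0<p (off-zero n) ⟩
    𝟙 ⟨ 0 ⟩ * g ⟨ n + neg 0 ⟩
      ≡⟨ cong₂ _*_ (trans (𝟙-⟨⟩ 0) (δ-≡ 0%p≡0)) (⟨⟩-cong g (+neg0≈ n)) ⟩
    1 * g ⟨ n ⟩                                ≡⟨ *-identityˡ _ ⟩
    g ⟨ n ⟩                                    ∎
    where
    off-zero : ∀ n i → i < p → i ≢ 0 → 𝟙 ⟨ i ⟩ * g ⟨ n + neg i ⟩ ≡ 0
    off-zero n i i<p i≢0 =
      cong (_* g ⟨ n + neg i ⟩) (trans (𝟙-⟨⟩ i) (δ-≢ (i≢0 ∘ trans (sym (m<n⇒m%n≡m i<p)))))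

  ·-identityʳ : ∀ g → g · 𝟙 ≋ g
  ·-identityʳ g = ≋-trans (·-comm g 𝟙) (·-identityˡ g)

  𝟘-zeroˡ : ∀ g → 𝟘 · g ≋ 𝟘
  𝟘-zeroˡ g = ⟨⟩≡⇒≋ (λ n → trans (·-⟨⟩ 𝟘 g n) (∑-zero p _ (λ _ _ → refl)))

  ·-distribˡ-⊕ : ∀ f g h → f · (g ⊕ h) ≋ f · g ⊕ f · h
  ·-distribˡ-⊕ f g h = ⟨⟩≡⇒≋ λ n → begin
    (f · (g ⊕ h)) ⟨ n ⟩
      ≡⟨ ·-⟨⟩ f (g ⊕ h) n ⟩
    ∑ p (λ i → f ⟨ i ⟩ * (g ⊕ h) ⟨ n + neg i ⟩)
      ≡⟨ ∑-cong p (λ i _ → trans (cong (f ⟨ i ⟩ *_) (⊕-⟨⟩ g h _)) (*-distribˡ-+ (f ⟨ i ⟩) _ _)) ⟩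
    ∑ p (λ i → f ⟨ i ⟩ * g ⟨ n + neg i ⟩ + f ⟨ i ⟩ * h ⟨ n + neg i ⟩)
      ≡⟨ ∑-+ p _ _ ⟩
    ∑ p (λ i → f ⟨ i ⟩ * g ⟨ n + neg i ⟩) + ∑ p (λ i → f ⟨ i ⟩ * h ⟨ n + neg i ⟩)
      ≡⟨ sym (cong₂ _+_ (·-⟨⟩ f g n) (·-⟨⟩ f h n)) ⟩
    (f · g) ⟨ n ⟩ + (f · h) ⟨ n ⟩
      ≡⟨ sym (⊕-⟨⟩ (f · g) (f · h) n) ⟩
    (f · g ⊕ f · h) ⟨ n ⟩ ∎

  ·-distribʳ-⊕ : ∀ f g h → (g ⊕ h) · f ≋ g · f ⊕ h · f
  ·-distribʳ-⊕ f g h =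
    ≋-trans (·-comm (g ⊕ h) f) (≋-trans (·-distribˡ-⊕ f g h) (⊕-cong (·-comm f g) (·-comm f h)))

  ·-interchange : ∀ a b c d → (a · b) · (c · d) ≋ (a · c) · (b · d)
  ·-interchange a b c d =
    ≋-trans (·-assoc a b (c · d))
    (≋-trans (·-congˡ a (≋-sym (·-assoc b c d)))
    (≋-trans (·-congˡ a (·-congʳ d (·-comm b c)))
    (≋-trans (·-congˡ a (·-assoc c b d))
    (≋-sym (·-assoc a c (b · d))))))

  inverse-unique : ∀ {f g g′} → f · g ≋ 𝟙 → f · g′ ≋ 𝟙 → g ≋ g′
  inverse-unique {f} {g} {g′} fg≋𝟙 fg′≋𝟙 =
    ≋-trans (≋-sym (·-identityʳ g))
    (≋-trans (·-congˡ g (≋-sym fg′≋𝟙))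
    (≋-trans (≋-sym (·-assoc g f g′))
    (≋-trans (·-congʳ g′ (·-comm g f))
    (≋-trans (·-congʳ g′ fg≋𝟙)
    (·-identityˡ g′)))))

  ∂-cong : ∀ {f g} → f ≋ g → ∂ f ≋ ∂ g
  ∂-cong {f} {g} f≋g = mk≋ λ i →
    trans (cong (_% p) (∂-def f i)) (trans (*-congˡ≈ (toℕ i) (get f≋g i)) (cong (_% p) (sym (∂-def g i))))

  ∂𝟙≋𝟘 : ∂ 𝟙 ≋ 𝟘
  ∂𝟙≋𝟘 = mk≋ (λ i → cong (_% p) (trans (∂-def 𝟙 i) (n*δn0≡0 (toℕ i))))
    where
    n*δn0≡0 : ∀ n → n * δ n 0 ≡ 0
    n*δn0≡0 zero    = refl
    n*δn0≡0 (suc n) = trans (cong (suc n *_) (δ-≢ {suc n} {0} (λ ()))) (*-zeroʳ (suc n))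

  ∂-leibniz : ∀ f g → ∂ (f · g) ≋ ∂ f · g ⊕ f · ∂ g
  ∂-leibniz f g = ⟨⟩≈⇒≋ λ n _ → begin
    ∂ (f · g) ⟨ n ⟩ % p
      ≡⟨ cong (_% p) (trans (∂-⟨⟩ (f · g) n) (cong (n % p *_) (·-⟨⟩ f g n))) ⟩
    (n % p * ∑ p (λ i → f ⟨ i ⟩ * g ⟨ n + neg i ⟩)) % p
      ≡⟨ cong (_% p) (sym (∑-*ˡ p (n % p) _)) ⟩
    ∑ p (λ i → n % p * (f ⟨ i ⟩ * g ⟨ n + neg i ⟩)) % p
      ≡⟨ ∑-cong≈ p (λ i _ → term n i) ⟩
    ∑ p (λ i → ∂ f ⟨ i ⟩ * g ⟨ n + neg i ⟩ + f ⟨ i ⟩ * ∂ g ⟨ n + neg i ⟩) % p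
      ≡⟨ cong (_% p) (∑-+ p _ _) ⟩
    (∑ p (λ i → ∂ f ⟨ i ⟩ * g ⟨ n + neg i ⟩) + ∑ p (λ i → f ⟨ i ⟩ * ∂ g ⟨ n + neg i ⟩)) % p
      ≡⟨ cong (_% p) (sym (trans (⊕-⟨⟩ (∂ f · g) (f · ∂ g) n)
                                 (cong₂ _+_ (·-⟨⟩ (∂ f) g n) (·-⟨⟩ f (∂ g) n)))) ⟩
    (∂ f · g ⊕ f · ∂ g) ⟨ n ⟩ % p ∎
    where
    term : ∀ n i → n % p * (f ⟨ i ⟩ * g ⟨ n + neg i ⟩) ≈
                   ∂ f ⟨ i ⟩ * g ⟨ n + neg i ⟩ + f ⟨ i ⟩ * ∂ g ⟨ n + neg i ⟩
    term n i = sym (begin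
      (∂ f ⟨ i ⟩ * G + f ⟨ i ⟩ * ∂ g ⟨ j ⟩) % p
        ≡⟨ cong (_% p) (cong₂ (λ a b → a * G + f ⟨ i ⟩ * b) (∂-⟨⟩ f i) (∂-⟨⟩ g j)) ⟩
      (i % p * f ⟨ i ⟩ * G + f ⟨ i ⟩ * (j % p * G)) % p
        ≡⟨ cong (_% p) (distrib (i % p) (j % p) (f ⟨ i ⟩) G) ⟩
      ((i % p + j % p) * (f ⟨ i ⟩ * G)) % p
        ≡⟨ *-congʳ≈ _ (trans (+-cong≈ (%≈ i) (%≈ j)) (trans (+[+neg]≈ n i) (sym (%≈ n)))) ⟩
      (n % p * (f ⟨ i ⟩ * G)) % p ∎)
      where
      j G : ℕ
      j = n + neg i
      G = g ⟨ j ⟩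
      distrib : ∀ a b F G → a * F * G + F * (b * G) ≡ (a + b) * (F * G)
      distrib = solve-∀

module LogarithmicDerivative (p : ℕ) .{{_ : NonZero p}} where
  open GroupRing p public

  moment : ℕ → R p → ℕ
  moment e h = ∑ p (λ i → i ^ e * h ⟨ i ⟩)

  moment-cong : ∀ e {f g} → f ≋ g → moment e f ≈ moment e g
  moment-cong e f≋g = ∑-cong≈ p (λ i _ → *-congˡ≈ (i ^ e) (≋⇒⟨⟩≈ f≋g i))

  moment-⊕ : ∀ e f g → moment e (f ⊕ g) ≡ moment e f + moment e g
  moment-⊕ e f g = trans (∑-cong p (λ i _ → trans (cong (i ^ e *_) (⊕-⟨⟩ f g i)) (*-distribˡ-+ (i ^ e) _ _)))
                         (∑-+ p _ _)

  moment-𝟘 : ∀ e → moment e 𝟘 ≡ 0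
  moment-𝟘 e = ∑-zero p _ (λ i _ → *-zeroʳ (i ^ e))

  -- ℒ e f f̃ is the e-th moment of ∂f / f, the inverse f̃ of f being passed explicitly.
  ℒ : ℕ → R p → R p → ℕ
  ℒ e f f̃ = moment e (∂ f · f̃)

  ℒ-cong : ∀ e {f f′ g g′} → f ≋ f′ → g ≋ g′ → ℒ e f g ≈ ℒ e f′ g′
  ℒ-cong e f≋f′ g≋g′ = moment-cong e (·-cong (∂-cong f≋f′) g≋g′)

  ℒ-𝟙 : ∀ e → ℒ e 𝟙 𝟙 ≈ 0
  ℒ-𝟙 e = trans (moment-cong e (≋-trans (·-congʳ 𝟙 ∂𝟙≋𝟘) (𝟘-zeroˡ 𝟙))) (cong (_% p) (moment-𝟘 e))

  ℒ-· : ∀ e {f f̃ g g̃} → f · f̃ ≋ 𝟙 → g · g̃ ≋ 𝟙 → ℒ e (f · g) (f̃ · g̃) ≈ ℒ e f f̃ + ℒ e g g̃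
  ℒ-· e {f} {f̃} {g} {g̃} ff̃≋𝟙 gg̃≋𝟙 =
    trans (moment-cong e logarithmic) (cong (_% p) (moment-⊕ e (∂ f · f̃) (∂ g · g̃)))
    where
    logarithmic : ∂ (f · g) · (f̃ · g̃) ≋ ∂ f · f̃ ⊕ ∂ g · g̃
    logarithmic =
      ≋-trans (·-congʳ (f̃ · g̃) (∂-leibniz f g))
      (≋-trans (·-distribʳ-⊕ (f̃ · g̃) (∂ f · g) (f · ∂ g))
      (⊕-cong (≋-trans (·-interchange (∂ f) g f̃ g̃) (≋-trans (·-congˡ (∂ f · f̃) gg̃≋𝟙) (·-identityʳ _)))
              (≋-trans (·-interchange f (∂ g) f̃ g̃) (≋-trans (·-congʳ (∂ g · g̃) ff̃≋𝟙) (·-identityˡ _)))))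

  pow : R p → ℕ → R p
  pow f zero    = 𝟙
  pow f (suc n) = f · pow f n

  powR≋pow : ∀ f n → powR p f n ≋ pow f n
  powR≋pow f zero    = ≋-refl
  powR≋pow f (suc n) = ≋-trans (mulR≋· f (powR p f n)) (·-congˡ f (powR≋pow f n))

  pow-inverse : ∀ {f f̃} → f · f̃ ≋ 𝟙 → ∀ n → pow f n · pow f̃ n ≋ 𝟙
  pow-inverse ff̃≋𝟙 zero    = ·-identityˡ 𝟙
  pow-inverse {f} {f̃} ff̃≋𝟙 (suc n) =
    ≋-trans (·-interchange f (pow f n) f̃ (pow f̃ n))
            (≋-trans (·-cong ff̃≋𝟙 (pow-inverse ff̃≋𝟙 n)) (·-identityˡ 𝟙))

  ℒ-pow : ∀ e {f f̃} → f · f̃ ≋ 𝟙 → ∀ n → ℒ e (pow f n) (pow f̃ n) ≈ n * ℒ e f f̃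
  ℒ-pow e ff̃≋𝟙 zero    = ℒ-𝟙 e
  ℒ-pow e {f} {f̃} ff̃≋𝟙 (suc n) =
    trans (ℒ-· e ff̃≋𝟙 (pow-inverse ff̃≋𝟙 n)) (+-congˡ≈ (ℒ e f f̃) (ℒ-pow e ff̃≋𝟙 n))

  ℒ-pthPower≈0 : ∀ e {P P̃ w w̃} → P · P̃ ≋ 𝟙 → w · w̃ ≋ 𝟙 → pow w p ≋ P → ℒ e P P̃ ≈ 0
  ℒ-pthPower≈0 e {P} {P̃} {w} {w̃} PP̃≋𝟙 ww̃≋𝟙 wᵖ≋P = begin
    ℒ e P P̃ % p                    ≡⟨ ℒ-cong e (≋-sym wᵖ≋P) P̃≋w̃ᵖ ⟩
    ℒ e (pow w p) (pow w̃ p) % p    ≡⟨ ℒ-pow e ww̃≋𝟙 p ⟩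
    (p * ℒ e w w̃) % p              ≡⟨ *-congʳ≈ (ℒ e w w̃) p≈0 ⟩
    0 % p                          ∎
    where
    open ≡-Reasoning
    P̃≋w̃ᵖ : P̃ ≋ pow w̃ p
    P̃≋w̃ᵖ = inverse-unique PP̃≋𝟙 (≋-trans (·-congʳ (pow w̃ p) (≋-sym wᵖ≋P)) (pow-inverse ww̃≋𝟙 p))

  prodPow : ∀ {m} → List (Fin m) → (Fin m → R p) → (Fin m → ℕ) → R p
  prodPow l f c = foldr (λ k acc → pow (f k) (c k) · acc) 𝟙 l

  prodPowR≋prodPow : ∀ m f c → prodPowR p m f c ≋ prodPow (allFin m) f c
  prodPowR≋prodPow m f c = go (allFin m)
    where
    go : ∀ l → foldr (λ k acc → mulR p (powR p (f k) (c k)) acc) (oneR p) l ≋ prodPow l f c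
    go []      = ≋-refl
    go (k ∷ l) = ≋-trans (mulR≋· (powR p (f k) (c k)) _) (·-cong (powR≋pow (f k) (c k)) (go l))

  prodPow-inverse : ∀ {m} (l : List (Fin m)) {f f̃ : Fin m → R p} c → (∀ k → f k · f̃ k ≋ 𝟙) →
                    prodPow l f c · prodPow l f̃ c ≋ 𝟙
  prodPow-inverse []      c inv = ·-identityˡ 𝟙
  prodPow-inverse (k ∷ l) {f} {f̃} c inv =
    ≋-trans (·-interchange (pow (f k) (c k)) (prodPow l f c) (pow (f̃ k) (c k)) (prodPow l f̃ c))
            (≋-trans (·-cong (pow-inverse (inv k) (c k)) (prodPow-inverse l c inv)) (·-identityˡ 𝟙))

  ℒ-prodPow : ∀ e {m} (l : List (Fin m)) {f f̃ : Fin m → R p} c → (∀ k → f k · f̃ k ≋ 𝟙) →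
              ℒ e (prodPow l f c) (prodPow l f̃ c) ≈ sum (map (λ k → c k * ℒ e (f k) (f̃ k)) l)
  ℒ-prodPow e []      c inv = ℒ-𝟙 e
  ℒ-prodPow e (k ∷ l) c inv =
    trans (ℒ-· e (pow-inverse (inv k) (c k)) (prodPow-inverse l c inv))
          (+-cong≈ (ℒ-pow e (inv k) (c k)) (ℒ-prodPow e l c inv))

module _ (p : ℕ) .{{_ : NonZero p}} (pr : Prime p) where
  open LogarithmicDerivative p
  open PrimeModulus pr

  -- Each ℒ (e j) is additive on units and kills p-th powers, so it sends Π Vᵢ^cᵢ ∈ (R^×)^p to cⱼ ℒ (e j) Vⱼ ≈ 0.
  linIndep-of-diagonal : ∀ r (V Ṽ : Fin r → R p) → (∀ i → V i · Ṽ i ≋ 𝟙) → (e : Fin r → ℕ) →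
                         (∀ i j → i ≢ j → ℒ (e j) (V i) (Ṽ i) ≈ 0) →
                         (∀ j → ¬ (ℒ (e j) (V j) (Ṽ j) ≈ 0)) →
                         LinIndep p r V
  linIndep-of-diagonal r V Ṽ VṼ≋𝟙 e off-diagonal diagonal c (w , (w̃ , ww̃≈1) , wᵖ≈P) j =
    ≈0⇒≡0 (cancel (euclid≈ (c j) _ cⱼℒⱼ≈0))
    where
    wᵖ≋P : pow w p ≋ prodPow (allFin r) V c
    wᵖ≋P = ≋-trans (≋-sym (powR≋pow w p)) (≋-trans (mk≋ wᵖ≈P) (prodPowR≋prodPow r V c))
    ww̃≋𝟙 : w · w̃ ≋ 𝟙
    ww̃≋𝟙 = ≋-trans (≋-sym (mulR≋· w w̃)) (mk≋ ww̃≈1)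
    ∑cℒ≈0 : sumFin r (λ i → c i * ℒ (e j) (V i) (Ṽ i)) ≈ 0
    ∑cℒ≈0 = trans (sym (ℒ-prodPow (e j) (allFin r) c VṼ≋𝟙))
                  (ℒ-pthPower≈0 (e j) (prodPow-inverse (allFin r) c VṼ≋𝟙) ww̃≋𝟙 wᵖ≋P)
    cⱼℒⱼ≈0 : c j * ℒ (e j) (V j) (Ṽ j) ≈ 0
    cⱼℒⱼ≈0 = trans (sym (sumFin-single≈ r _ j (λ i i≢j →
                trans (*-congˡ≈ (c i) (off-diagonal i j i≢j)) (cong (_% p) (*-zeroʳ (c i))))))
                   ∑cℒ≈0
    cancel : c j ≈ 0 ⊎ ℒ (e j) (V j) (Ṽ j) ≈ 0 → c j ≈ 0
    cancel (inj₁ cⱼ≈0) = cⱼ≈0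
    cancel (inj₂ ℒⱼ≈0) = ⊥-elim (diagonal j ℒⱼ≈0)

odd-prime⇒2<p : ∀ {p} → Prime p → p % 2 ≡ 1 → 2 < p
odd-prime⇒2<p {p} pr odd with m≤n⇒m<n∨m≡n (nonTrivial⇒n>1 p {{prime⇒nonTrivial pr}})
... | inj₁ 2<p = 2<p
... | inj₂ 2≡p = ⊥-elim (0≢1+n (subst (λ q → q % 2 ≡ 1) (sym 2≡p) odd))

module Generator (p : ℕ) .{{_ : NonZero p}} (pr : Prime p) (2<p : 2 < p) (s : ℕ) (gen : GeneratesUnits p s) where
  open Congruence p
  open PrimeModulus pr
  open ≡-Reasoning

  instance
    p∸1-nonZero : NonZero (p ∸ 1)
    p∸1-nonZero = >-nonZero (∸-monoˡ-< 1<p ≤-refl)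

  s≉0 : ¬ (s ≈ 0)
  s≉0 s≈0 = no-power (proj₁ sⁿ≈2) (proj₂ sⁿ≈2)
    where
    sⁿ≈2 : ∃ λ n → s ^ n ≈ 2
    sⁿ≈2 = gen 2 (λ 2≡0 → <p⇒≉0 z<s 2<p (≡0⇒≈0 2≡0))
    no-power : ∀ n → s ^ n ≈ 2 → ⊥
    no-power zero    1≈2 = <p⇒≉0 z<s 1<p (+-cancelʳ≈ 1 (sym 1≈2))
    no-power (suc n) sⁿ⁺¹≈2 = <p⇒≉0 z<s 2<p (trans (sym sⁿ⁺¹≈2) (*-congʳ≈ (s ^ n) s≈0))

  suc-toℕ<p : ∀ (i : Fin (p ∸ 1)) → suc (toℕ i) < p
  suc-toℕ<p i = subst (suc (toℕ i) <_) suc[p∸1]≡p (s<s (toℕ<n i))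

  log : Fin (p ∸ 1) → ℕ
  log i = proj₁ (gen (suc (toℕ i)) (λ i+1≡0 → <p⇒≉0 z<s (suc-toℕ<p i) (≡0⇒≈0 i+1≡0)))

  s^log : ∀ i → s ^ log i ≈ suc (toℕ i)
  s^log i = proj₂ (gen (suc (toℕ i)) (λ i+1≡0 → <p⇒≉0 z<s (suc-toℕ<p i) (≡0⇒≈0 i+1≡0)))

  -- The discrete logarithm reduced mod e would inject the p - 1 units into e residues.
  order-≥ : ∀ e .{{_ : NonZero e}} → s ^ e ≈ 1 → p ∸ 1 ≤ e
  order-≥ e sᵉ≈1 with e <? p ∸ 1
  ... | no  e≮p∸1 = ≮⇒≥ e≮p∸1
  ... | yes e<p∸1 with pigeonhole e<p∸1 (λ i → fromℕ< (m%n<n (log i) e))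
  ...   | i , j , i<j , same = ⊥-elim $ <-irrefl (suc-injective (<p-≈-injective (suc-toℕ<p i) (suc-toℕ<p j) i+1≈j+1)) i<j
    where
    same-residue : log i % e ≡ log j % e
    same-residue = trans (sym (toℕ-fromℕ< (m%n<n (log i) e))) (trans (cong toℕ same) (toℕ-fromℕ< (m%n<n (log j) e)))
    i+1≈j+1 : suc (toℕ i) ≈ suc (toℕ j)
    i+1≈j+1 = begin
      suc (toℕ i) % p     ≡⟨ sym (s^log i) ⟩
      s ^ log i % p       ≡⟨ ^-%≈ s e (log i) sᵉ≈1 ⟩
      s ^ (log i % e) % p ≡⟨ cong (λ t → s ^ t % p) same-residue ⟩
      s ^ (log j % e) % p ≡⟨ sym (^-%≈ s e (log j) sᵉ≈1) ⟩
      s ^ log j % p       ≡⟨ s^log j ⟩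
      suc (toℕ j) % p     ∎

  residueIndex : ∀ a → ¬ (a ≈ 0) → Fin (p ∸ 1)
  residueIndex a a≉0 = fromℕ< (subst (pred (a % p) <_) (pred[m∸n]≡m∸[1+n] p 0)
                                     (pred-mono-< {{≢-nonZero (a≉0 ∘ ≡0⇒≈0)}} (m%n<n a p)))

  residueIndex-injective : ∀ {a b} a≉0 b≉0 → residueIndex a a≉0 ≡ residueIndex b b≉0 → a ≈ b
  residueIndex-injective {a} {b} a≉0 b≉0 same =
    pred-injective {{≢-nonZero (a≉0 ∘ ≡0⇒≈0)}} {{≢-nonZero (b≉0 ∘ ≡0⇒≈0)}}
      (trans (sym (toℕ-fromℕ< _)) (trans (cong toℕ same) (toℕ-fromℕ< _)))

  -- Two of the p powers s⁰, …, s^(p-1) coincide, and their quotient has order at least p - 1.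
  s^[p∸1]≈1 : s ^ (p ∸ 1) ≈ 1
  s^[p∸1]≈1 with pigeonhole (subst (p ∸ 1 <_) suc[p∸1]≡p ≤-refl) (λ i → residueIndex (s ^ toℕ i) (^-≉0 (toℕ i) s≉0))
  ... | i , j , i<j , same =
    subst (λ d → s ^ d ≈ 1) (≤-antisym d≤p∸1 (order-≥ d {{>-nonZero (m<n⇒0<n∸m i<j)}} sᵈ≈1)) sᵈ≈1
    where
    a b d : ℕ
    a = toℕ i
    b = toℕ j
    d = b ∸ a
    d≤p∸1 : d ≤ p ∸ 1
    d≤p∸1 = ≤-trans (m∸n≤m b a) (s≤s⁻¹ (subst (b <_) (sym suc[p∸1]≡p) (toℕ<n j)))
    sᵈ≈1 : s ^ d ≈ 1
    sᵈ≈1 = *-cancelˡ≈ (^-≉0 a s≉0) (begin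
      (s ^ a * s ^ d) % p   ≡⟨ cong (_% p) (sym (^-distribˡ-+-* s a d)) ⟩
      s ^ (a + d) % p       ≡⟨ cong (λ t → s ^ t % p) (m+[n∸m]≡n (<⇒≤ i<j)) ⟩
      s ^ b % p             ≡⟨ sym (residueIndex-injective (^-≉0 a s≉0) (^-≉0 b s≉0) same) ⟩
      s ^ a % p             ≡⟨ cong (_% p) (sym (*-identityʳ (s ^ a))) ⟩
      (s ^ a * 1) % p       ∎)

  s^≈1⇒∣ : ∀ a → s ^ a ≈ 1 → a % (p ∸ 1) ≡ 0
  s^≈1⇒∣ a sᵃ≈1 with a % (p ∸ 1) in eq
  ... | zero  = refl
  ... | suc r = ⊥-elim (<⇒≱ (subst (_< p ∸ 1) eq (m%n<n a (p ∸ 1))) (order-≥ (suc r) sʳ⁺¹≈1))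
    where
    sʳ⁺¹≈1 : s ^ suc r ≈ 1
    sʳ⁺¹≈1 = trans (sym (subst (λ t → s ^ a ≈ s ^ t) eq (^-%≈ s (p ∸ 1) a s^[p∸1]≈1))) sᵃ≈1

  ∣⇒s^≈1 : ∀ a → a % (p ∸ 1) ≡ 0 → s ^ a ≈ 1
  ∣⇒s^≈1 a a%[p∸1]≡0 = trans (^-%≈ s (p ∸ 1) a s^[p∸1]≈1) (cong (λ t → s ^ t % p) a%[p∸1]≡0)

  fermat : ∀ a → ¬ (a ≈ 0) → a ^ (p ∸ 1) ≈ 1
  fermat a a≉0 with gen a (a≉0 ∘ ≡0⇒≈0)
  ... | n , sⁿ≈a = begin
    a ^ (p ∸ 1) % p          ≡⟨ ^-cong≈ (p ∸ 1) (sym sⁿ≈a) ⟩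
    (s ^ n) ^ (p ∸ 1) % p
      ≡⟨ cong (_% p) (trans (^-*-assoc s n (p ∸ 1)) (trans (cong (s ^_) (*-comm n (p ∸ 1))) (sym (^-*-assoc s (p ∸ 1) n)))) ⟩
    (s ^ (p ∸ 1)) ^ n % p    ≡⟨ ^-cong≈ n s^[p∸1]≈1 ⟩
    1 ^ n % p                ≡⟨ cong (_% p) (^-zeroˡ n) ⟩
    1 % p                    ∎

  frobenius : ∀ a → a ^ p ≈ a
  frobenius a with a % p ≟ 0 % p
  ... | yes a≈0 = begin
    a ^ p % p                  ≡⟨ cong (λ t → a ^ t % p) (sym suc[p∸1]≡p) ⟩
    (a * a ^ (p ∸ 1)) % p      ≡⟨ *-congʳ≈ (a ^ (p ∸ 1)) a≈0 ⟩
    (0 * a ^ (p ∸ 1)) % p      ≡⟨ sym a≈0 ⟩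
    a % p                      ∎
  ... | no a≉0 = begin
    a ^ p % p                  ≡⟨ cong (λ t → a ^ t % p) (sym suc[p∸1]≡p) ⟩
    (a * a ^ (p ∸ 1)) % p      ≡⟨ *-congˡ≈ a (fermat a a≉0) ⟩
    (a * 1) % p                ≡⟨ cong (_% p) (*-identityʳ a) ⟩
    a % p                      ∎

module BinomialUnits (p : ℕ) .{{_ : NonZero p}} (x y : ℕ) where
  open LogarithmicDerivative p
  open ≡-Reasoning

  ℓ : ℕ → R p
  ℓ b = linR p x y b

  ℓ-⟨⟩ : ∀ b i → ℓ b ⟨ i ⟩ ≡ δ (i % p) 0 * x + δ (i % p) (b % p) * neg y
  ℓ-⟨⟩ b i = trans (cong₂ _+_ (if-x-0≡if-1-0*x (does (toℕ (ix p i) ≟ 0)) x)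
                              (if-x-0≡if-1-0*x (does (toℕ (ix p i) ≟ b % p)) (neg y)))
                   (cong₂ (λ t₁ t₂ → δ t₁ 0 * x + δ t₂ (b % p) * neg y) (toℕ-ix i) (toℕ-ix i))

  ℓ·-⟨⟩ : ∀ b F n → (ℓ b · F) ⟨ n ⟩ ≡ x * F ⟨ n ⟩ + neg y * F ⟨ n + neg b ⟩
  ℓ·-⟨⟩ b F n = begin
    (ℓ b · F) ⟨ n ⟩
      ≡⟨ ·-⟨⟩ (ℓ b) F n ⟩
    ∑ p (λ i → ℓ b ⟨ i ⟩ * F ⟨ n + neg i ⟩)
      ≡⟨ ∑-cong p (λ i _ → trans (cong (_* F ⟨ n + neg i ⟩) (ℓ-⟨⟩ b i))
                                 (split (δ (i % p) 0) (δ (i % p) (b % p)) x (neg y) _)) ⟩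
    ∑ p (λ i → δ (i % p) 0 * (x * F ⟨ n + neg i ⟩) + δ (i % p) (b % p) * (neg y * F ⟨ n + neg i ⟩))
      ≡⟨ ∑-+ p _ _ ⟩
    ∑ p (λ i → δ (i % p) 0 * (x * F ⟨ n + neg i ⟩)) + ∑ p (λ i → δ (i % p) (b % p) * (neg y * F ⟨ n + neg i ⟩))
      ≡⟨ cong₂ _+_ (∑-δ-at 0 _ 0<p) (∑-δ-at (b % p) _ (m%n<n b p)) ⟩
    x * F ⟨ n + neg 0 ⟩ + neg y * F ⟨ n + neg (b % p) ⟩
      ≡⟨ cong₂ (λ u v → x * u + neg y * v) (⟨⟩-cong F (+neg0≈ n)) (cong (λ t → F ⟨ n + t ⟩) (neg-cong (%≈ b))) ⟩
    x * F ⟨ n ⟩ + neg y * F ⟨ n + neg b ⟩ ∎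
    where
    split : ∀ d d′ a b F → (d * a + d′ * b) * F ≡ d * (a * F) + d′ * (b * F)
    split = solve-∀

  ∂ℓ-⟨⟩ : ∀ b i → ∂ (ℓ b) ⟨ i ⟩ ≡ δ (i % p) (b % p) * (b % p * neg y)
  ∂ℓ-⟨⟩ b i = begin
    ∂ (ℓ b) ⟨ i ⟩                                                  ≡⟨ ∂-⟨⟩ (ℓ b) i ⟩
    i % p * ℓ b ⟨ i ⟩                                              ≡⟨ cong (i % p *_) (ℓ-⟨⟩ b i) ⟩
    i % p * (δ (i % p) 0 * x + δ (i % p) (b % p) * neg y)          ≡⟨ *-distribˡ-+ (i % p) _ _ ⟩
    i % p * (δ (i % p) 0 * x) + i % p * (δ (i % p) (b % p) * neg y)
      ≡⟨ cong₂ _+_ (n*[δn0*x]≡0 (i % p) x) (n*[δnc*x]≡δnc*[c*x] (i % p) (b % p) (neg y)) ⟩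
    δ (i % p) (b % p) * (b % p * neg y)                            ∎
    where
    n*[δn0*x]≡0 : ∀ n x → n * (δ n 0 * x) ≡ 0
    n*[δn0*x]≡0 zero    x = refl
    n*[δn0*x]≡0 (suc n) x = trans (cong (λ d → suc n * (d * x)) (δ-≢ {suc n} {0} (λ ()))) (*-zeroʳ (suc n))
    n*[δnc*x]≡δnc*[c*x] : ∀ n c x → n * (δ n c * x) ≡ δ n c * (c * x)
    n*[δnc*x]≡δnc*[c*x] n c x with n ≟ c
    ... | yes refl = trans (cong (λ d → n * (d * x)) (δ-≡ {n} refl))
                           (trans (x∙yz≈y∙xz n 1 x) (cong (_* (n * x)) (sym (δ-≡ {n} refl))))
    ... | no  n≢c  = trans (cong (λ d → n * (d * x)) (δ-≢ n≢c)) (trans (*-zeroʳ n) (cong (_* (c * x)) (sym (δ-≢ n≢c))))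

  geom : ℕ → ℕ
  geom j = x ^ (p ∸ 1 ∸ j) * y ^ j

  -- ∑_{j<p} x^(p-1-j) y^j t^(bj): the inverse of x - y t^b when x^p - y^p = 1.
  ℓ⁻¹ : ℕ → R p
  ℓ⁻¹ b i = ∑ p (λ j → δ ((b * j) % p) (toℕ i) * geom j)

  ℓ⁻¹-⟨⟩ : ∀ b n → ℓ⁻¹ b ⟨ n ⟩ ≡ ∑ p (λ j → δ ((b * j) % p) (n % p) * geom j)
  ℓ⁻¹-⟨⟩ b n = ∑-cong p (λ j _ → cong (λ t → δ ((b * j) % p) t * geom j) (toℕ-ix n))

  ℓ⁻¹-⟨-b⟩ : ∀ b n → ℓ⁻¹ b ⟨ n + neg b ⟩ ≡ ∑ p (λ j → δ ((b * suc j) % p) (n % p) * geom j)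
  ℓ⁻¹-⟨-b⟩ b n = trans (ℓ⁻¹-⟨⟩ b (n + neg b)) (∑-cong p (λ j _ → cong (_* geom j) (δ-cong-⇔ (to j) (from j))))
    where
    b+[n-b]≈n : b + (n + neg b) ≈ n
    b+[n-b]≈n = +[+neg]≈ n b
    to : ∀ j → b * j ≈ n + neg b → b * suc j ≈ n
    to j bj≈n-b = trans (cong (_% p) (*-suc b j)) (trans (+-congˡ≈ b bj≈n-b) b+[n-b]≈n)
    from : ∀ j → b * suc j ≈ n → b * j ≈ n + neg b
    from j b[j+1]≈n = +-cancelˡ≈ b (trans (sym (cong (_% p) (*-suc b j))) (trans b[j+1]≈n (sym b+[n-b]≈n)))

  τ : ℕ → ℕ
  τ e = ∑ p (λ j → geom j * y * suc j ^ e)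

  ∂ℓ·-⟨⟩ : ∀ b F n → (∂ (ℓ b) · F) ⟨ n ⟩ ≡ b % p * neg y * F ⟨ n + neg b ⟩
  ∂ℓ·-⟨⟩ b F n = begin
    (∂ (ℓ b) · F) ⟨ n ⟩
      ≡⟨ ·-⟨⟩ (∂ (ℓ b)) F n ⟩
    ∑ p (λ i → ∂ (ℓ b) ⟨ i ⟩ * F ⟨ n + neg i ⟩)
      ≡⟨ ∑-cong p (λ i _ → trans (cong (_* F ⟨ n + neg i ⟩) (∂ℓ-⟨⟩ b i)) (*-assoc (δ (i % p) (b % p)) _ _)) ⟩
    ∑ p (λ i → δ (i % p) (b % p) * (b % p * neg y * F ⟨ n + neg i ⟩))
      ≡⟨ ∑-δ-at (b % p) _ (m%n<n b p) ⟩
    b % p * neg y * F ⟨ n + neg (b % p) ⟩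
      ≡⟨ cong (λ t → b % p * neg y * F ⟨ n + t ⟩) (neg-cong (%≈ b)) ⟩
    b % p * neg y * F ⟨ n + neg b ⟩ ∎

  ℒ-ℓ≡ : ∀ e b → ℒ e (ℓ b) (ℓ⁻¹ b) ≡ ∑ p (λ j → ((b * suc j) % p) ^ e * (b % p * neg y * geom j))
  ℒ-ℓ≡ e b = begin
    ∑ p (λ n → n ^ e * (∂ (ℓ b) · ℓ⁻¹ b) ⟨ n ⟩)
      ≡⟨ ∑-cong p (λ n _ → cong (n ^ e *_) (trans (∂ℓ·-⟨⟩ b (ℓ⁻¹ b) n) (cong (β *_) (ℓ⁻¹-⟨-b⟩ b n)))) ⟩
    ∑ p (λ n → n ^ e * (β * ∑ p (λ j → δ (c j) (n % p) * geom j)))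
      ≡⟨ ∑-cong p (λ n _ → trans (cong (n ^ e *_) (sym (∑-*ˡ p β _))) (sym (∑-*ˡ p (n ^ e) _))) ⟩
    ∑ p (λ n → ∑ p (λ j → n ^ e * (β * (δ (c j) (n % p) * geom j))))
      ≡⟨ ∑-swap p p _ ⟩
    ∑ p (λ j → ∑ p (λ n → n ^ e * (β * (δ (c j) (n % p) * geom j))))
      ≡⟨ ∑-cong p (λ j _ → ∑-cong p (λ n _ →
           trans (pull-out (n ^ e) β (δ (c j) (n % p)) (geom j)) (cong (_* (n ^ e * (β * geom j))) (δ-sym (c j) (n % p))))) ⟩
    ∑ p (λ j → ∑ p (λ n → δ (n % p) (c j) * (n ^ e * (β * geom j))))
      ≡⟨ ∑-cong p (λ j _ → ∑-δ-at (c j) _ (m%n<n _ p)) ⟩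
    ∑ p (λ j → c j ^ e * (β * geom j)) ∎
    where
    β : ℕ
    β = b % p * neg y
    c : ℕ → ℕ
    c j = (b * suc j) % p
    pull-out : ∀ a b c d → a * (b * (c * d)) ≡ c * (a * (b * d))
    pull-out = solve-∀

  ℒ-ℓ : ∀ e b → ℒ e (ℓ b) (ℓ⁻¹ b) + b ^ suc e * τ e ≈ 0
  ℒ-ℓ e b = begin
    (ℒ e (ℓ b) (ℓ⁻¹ b) + b ^ suc e * τ e) % p
      ≡⟨ cong (_% p) (cong₂ _+_ (ℒ-ℓ≡ e b) (sym (∑-*ˡ p (b ^ suc e) _))) ⟩
    (∑ p t₁ + ∑ p t₂) % p
      ≡⟨ cong (_% p) (sym (∑-+ p t₁ t₂)) ⟩
    ∑ p (λ j → t₁ j + t₂ j) % p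
      ≡⟨ ∑-cong≈ p (λ j _ → cancel j) ⟩
    ∑ p (λ _ → 0) % p
      ≡⟨ cong (_% p) (∑-zero p _ (λ _ _ → refl)) ⟩
    0 % p ∎
    where
    t₁ t₂ : ℕ → ℕ
    t₁ j = ((b * suc j) % p) ^ e * (b % p * neg y * geom j)
    t₂ j = b ^ suc e * (geom j * y * suc j ^ e)
    factor : ∀ B Bᵉ J g n y → Bᵉ * J * (B * n * g) + B * Bᵉ * (g * y * J) ≡ B * Bᵉ * J * g * (n + y)
    factor = solve-∀
    cancel : ∀ j → t₁ j + t₂ j ≈ 0
    cancel j = begin
      (t₁ j + t₂ j) % p
        ≡⟨ +-congʳ≈ (t₂ j) (*-cong≈ (^-cong≈ e (%≈ (b * suc j))) (*-congʳ≈ (geom j) (*-congʳ≈ (neg y) (%≈ b)))) ⟩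
      ((b * suc j) ^ e * (b * neg y * geom j) + t₂ j) % p
        ≡⟨ cong (λ t → (t * (b * neg y * geom j) + t₂ j) % p) (^-distribʳ-* b (suc j) e) ⟩
      (b ^ e * suc j ^ e * (b * neg y * geom j) + b * b ^ e * (geom j * y * suc j ^ e)) % p
        ≡⟨ cong (_% p) (factor b (b ^ e) (suc j ^ e) (geom j) (neg y) y) ⟩
      (b * b ^ e * suc j ^ e * geom j * (neg y + y)) % p
        ≡⟨ *-congˡ≈ (b * b ^ e * suc j ^ e * geom j) (neg+≈0 y) ⟩
      (b * b ^ e * suc j ^ e * geom j * 0) % p
        ≡⟨ cong (_% p) (*-zeroʳ (b * b ^ e * suc j ^ e * geom j)) ⟩
      0 % p ∎

  module Inverse (xᵖ≈1+yᵖ : x ^ p ≈ 1 + y ^ p) where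

    geom-telescopes : ∀ j → j < p ∸ 1 → x * geom (suc j) + neg y * geom j ≈ 0
    geom-telescopes j j<p∸1 = begin
      (x * (x ^ q * (y * y ^ j)) + neg y * (x ^ (p ∸ 1 ∸ j) * y ^ j)) % p
        ≡⟨ cong (λ t → (x * (x ^ q * (y * y ^ j)) + neg y * (x ^ t * y ^ j)) % p) (m∸n≡1+[m∸1+n] (p ∸ 1) j j<p∸1) ⟩
      (x * (x ^ q * (y * y ^ j)) + neg y * (x * x ^ q * y ^ j)) % p
        ≡⟨ cong (_% p) (factor x (x ^ q) y (y ^ j) (neg y)) ⟩
      (x * x ^ q * y ^ j * (y + neg y)) % p
        ≡⟨ *-congˡ≈ (x * x ^ q * y ^ j) (+neg≈0 y) ⟩
      (x * x ^ q * y ^ j * 0) % p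
        ≡⟨ cong (_% p) (*-zeroʳ (x * x ^ q * y ^ j)) ⟩
      0 % p ∎
      where
      q : ℕ
      q = p ∸ 1 ∸ suc j
      factor : ∀ x X y Y n → x * (X * (y * Y)) + n * (x * X * Y) ≡ x * X * Y * (y + n)
      factor = solve-∀

    geom-ends : x * geom 0 + neg y * geom (p ∸ 1) ≈ 1
    geom-ends = +-cancelʳ≈ (y ^ p) (begin
      (x * geom 0 + neg y * geom (p ∸ 1) + y ^ p) % p
        ≡⟨ cong (λ t → (x * (x ^ (p ∸ 1) * 1) + neg y * (x ^ t * y ^ (p ∸ 1)) + y ^ p) % p) (n∸n≡0 (p ∸ 1)) ⟩
      (x * (x ^ (p ∸ 1) * 1) + neg y * (1 * y ^ (p ∸ 1)) + y ^ p) % p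
        ≡⟨ cong (λ t → (x * (x ^ (p ∸ 1) * 1) + neg y * (1 * y ^ (p ∸ 1)) + y ^ t) % p) (sym suc[p∸1]≡p) ⟩
      (x * (x ^ (p ∸ 1) * 1) + neg y * (1 * y ^ (p ∸ 1)) + y * y ^ (p ∸ 1)) % p
        ≡⟨ cong (_% p) (regroup x (x ^ (p ∸ 1)) y (y ^ (p ∸ 1)) (neg y)) ⟩
      (x * x ^ (p ∸ 1) + (y + neg y) * y ^ (p ∸ 1)) % p
        ≡⟨ +-congˡ≈ (x * x ^ (p ∸ 1)) (*-congʳ≈ (y ^ (p ∸ 1)) (+neg≈0 y)) ⟩
      (x * x ^ (p ∸ 1) + 0 * y ^ (p ∸ 1)) % p
        ≡⟨ cong (λ t → (x ^ t + 0) % p) suc[p∸1]≡p ⟩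
      (x ^ p + 0) % p
        ≡⟨ cong (_% p) (+-identityʳ (x ^ p)) ⟩
      x ^ p % p
        ≡⟨ xᵖ≈1+yᵖ ⟩
      (1 + y ^ p) % p ∎)
      where
      regroup : ∀ x X y Y n → x * (X * 1) + n * (1 * Y) + y * Y ≡ x * X + (y + n) * Y
      regroup = solve-∀

    ℓ·ℓ⁻¹≋𝟙 : ∀ b → ℓ b · ℓ⁻¹ b ≋ 𝟙
    ℓ·ℓ⁻¹≋𝟙 b = ⟨⟩≈⇒≋ λ n _ → begin
      (ℓ b · ℓ⁻¹ b) ⟨ n ⟩ % p
        ≡⟨ cong (_% p) (ℓ·-⟨⟩ b (ℓ⁻¹ b) n) ⟩
      (x * ℓ⁻¹ b ⟨ n ⟩ + neg y * ℓ⁻¹ b ⟨ n + neg b ⟩) % p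
        ≡⟨ cong (_% p) (cong₂ _+_ (trans (cong (x *_) (ℓ⁻¹-⟨⟩ b n)) (pull-in x (λ j → δ ((b * j) % p) (n % p))))
                                   (trans (cong (neg y *_) (ℓ⁻¹-⟨-b⟩ b n)) (pull-in (neg y) (λ j → δ ((b * suc j) % p) (n % p))))) ⟩
      (∑ p (λ j → h n j * (x * geom j)) + ∑ p (λ j → h n (suc j) * (neg y * geom j))) % p
        ≡⟨ cong (λ q → (∑ q (λ j → h n j * (x * geom j)) + ∑ q (λ j → h n (suc j) * (neg y * geom j))) % p) (sym suc[p∸1]≡p) ⟩
      (∑ (suc (p ∸ 1)) (λ j → h n j * (x * geom j)) + ∑ (suc (p ∸ 1)) (λ j → h n (suc j) * (neg y * geom j))) % p
        ≡⟨ ∑-telescope≈ (p ∸ 1) (h n) (λ j → x * geom j) (λ j → neg y * geom j) geom-telescopes ⟩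
      (h n 0 * (x * geom 0) + h n (suc (p ∸ 1)) * (neg y * geom (p ∸ 1))) % p
        ≡⟨ cong (_% p) (cong₂ (λ a c → a * (x * geom 0) + c * (neg y * geom (p ∸ 1))) (h-0 n) (h-p n)) ⟩
      (δ 0 (n % p) * (x * geom 0) + δ 0 (n % p) * (neg y * geom (p ∸ 1))) % p
        ≡⟨ cong (_% p) (sym (*-distribˡ-+ (δ 0 (n % p)) _ _)) ⟩
      (δ 0 (n % p) * (x * geom 0 + neg y * geom (p ∸ 1))) % p
        ≡⟨ *-congˡ≈ (δ 0 (n % p)) geom-ends ⟩
      (δ 0 (n % p) * 1) % p
        ≡⟨ cong (_% p) (trans (*-identityʳ _) (trans (δ-sym 0 (n % p)) (sym (𝟙-⟨⟩ n)))) ⟩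
      𝟙 ⟨ n ⟩ % p ∎
      where
      h : ℕ → ℕ → ℕ
      h n j = δ ((b * j) % p) (n % p)
      pull-in : ∀ c (d : ℕ → ℕ) → c * ∑ p (λ j → d j * geom j) ≡ ∑ p (λ j → d j * (c * geom j))
      pull-in c d = trans (sym (∑-*ˡ p c _)) (∑-cong p (λ j _ → x∙yz≈y∙xz c (d j) (geom j)))
      h-0 : ∀ n → h n 0 ≡ δ 0 (n % p)
      h-0 n = cong (λ t → δ t (n % p)) (trans (cong (_% p) (*-zeroʳ b)) 0%p≡0)
      h-p : ∀ n → h n (suc (p ∸ 1)) ≡ δ 0 (n % p)
      h-p n = cong (λ t → δ t (n % p)) (trans (cong (λ t → (b * t) % p) suc[p∸1]≡p) (m*n%n≡0 b p))

    ratio-inverse : ∀ b {z} → z · ℓ (neg b) ≋ ℓ b → z · (ℓ (neg b) · ℓ⁻¹ b) ≋ 𝟙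
    ratio-inverse b {z} zℓ≋ℓ =
      ≋-trans (≋-sym (·-assoc z (ℓ (neg b)) (ℓ⁻¹ b))) (≋-trans (·-congʳ (ℓ⁻¹ b) zℓ≋ℓ) (ℓ·ℓ⁻¹≋𝟙 b))

    -- ℒ is additive, ℒ(x - y t^b) = -b^(e+1) τ(e), and b ↦ b^(e+1) is odd.
    ℒ-ratio : ∀ k b {z} → z · ℓ (neg b) ≋ ℓ b →
              ℒ (2 * k) z (ℓ (neg b) · ℓ⁻¹ b) + 2 * (b ^ suc (2 * k) * τ (2 * k)) ≈ 0
    ℒ-ratio k b {z} zℓ≋ℓ = +-cancelʳ≈ L̄ (begin
      (ℒz + 2 * α + L̄) % p        ≡⟨ cong (_% p) (regroup ℒz L̄ α) ⟩
      (ℒz + L̄ + α + α) % p        ≡⟨ +-congʳ≈ α (+-congʳ≈ α sum-rule) ⟩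
      (L + α + α) % p              ≡⟨ +-congʳ≈ α (ℒ-ℓ e b) ⟩
      (0 + α) % p                  ≡⟨ sym L̄≈α ⟩
      (0 + L̄) % p                  ∎)
      where
      e : ℕ
      e = 2 * k
      z̃ : R p
      z̃ = ℓ (neg b) · ℓ⁻¹ b
      ℒz L L̄ α : ℕ
      ℒz = ℒ e z z̃
      L = ℒ e (ℓ b) (ℓ⁻¹ b)
      L̄ = ℒ e (ℓ (neg b)) (ℓ⁻¹ (neg b))
      α = b ^ suc e * τ e
      regroup : ∀ a b c → a + 2 * c + b ≡ a + b + c + c
      regroup = solve-∀
      z̃ℓ⁻¹≋ℓ⁻¹ : z̃ · ℓ⁻¹ (neg b) ≋ ℓ⁻¹ b
      z̃ℓ⁻¹≋ℓ⁻¹ = ≋-trans (·-congʳ (ℓ⁻¹ (neg b)) (·-comm (ℓ (neg b)) (ℓ⁻¹ b)))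
                 (≋-trans (·-assoc (ℓ⁻¹ b) (ℓ (neg b)) (ℓ⁻¹ (neg b)))
                 (≋-trans (·-congˡ (ℓ⁻¹ b) (ℓ·ℓ⁻¹≋𝟙 (neg b))) (·-identityʳ (ℓ⁻¹ b))))
      sum-rule : ℒz + L̄ ≈ L
      sum-rule = trans (sym (ℒ-· e (ratio-inverse b zℓ≋ℓ) (ℓ·ℓ⁻¹≋𝟙 (neg b)))) (ℒ-cong e zℓ≋ℓ z̃ℓ⁻¹≋ℓ⁻¹)
      ᾱ+α≈0 : neg b ^ suc e * τ e + α ≈ 0
      ᾱ+α≈0 = trans (cong (_% p) (sym (*-distribʳ-+ (τ e) (neg b ^ suc e) (b ^ suc e))))
                    (trans (*-congʳ≈ (τ e) (neg^odd+^odd≈0 b k)) (cong (_% p) (*-zeroˡ (τ e))))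
      L̄≈α : L̄ ≈ α
      L̄≈α = neg-unique (ℒ-ℓ e (neg b)) (trans (cong (_% p) (+-comm α _)) ᾱ+α≈0)

  module _ (u : ℕ) (uy≈x : u * y ≈ x) where

    τ-even≈ : ∀ k → τ (2 * k) ≈ y ^ p * ∑ p (λ i → i ^ (2 * k) * u ^ i)
    τ-even≈ k = begin
      τ e % p
        ≡⟨ cong (_% p) (∑-reverse p _) ⟩
      ∑ p (λ i → geom (p ∸ suc i) * y * suc (p ∸ suc i) ^ e) % p
        ≡⟨ ∑-cong≈ p term ⟩
      ∑ p (λ i → y ^ p * (i ^ e * u ^ i)) % p
        ≡⟨ cong (_% p) (∑-*ˡ p (y ^ p) _) ⟩
      (y ^ p * ∑ p (λ i → i ^ e * u ^ i)) % p ∎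
      where
      e : ℕ
      e = 2 * k
      regroup : ∀ a b c d → a * b * c * d ≡ (b * c) * (d * a)
      regroup = solve-∀
      term : ∀ i → i < p → geom (p ∸ suc i) * y * suc (p ∸ suc i) ^ e ≈ y ^ p * (i ^ e * u ^ i)
      term i i<p = begin
        (x ^ (p ∸ 1 ∸ (p ∸ suc i)) * y ^ (p ∸ suc i) * y * suc (p ∸ suc i) ^ e) % p
          ≡⟨ cong (_% p) (cong₂ (λ a c → x ^ a * y ^ (p ∸ suc i) * y * c ^ e) exponent (sym (m∸n≡1+[m∸1+n] p i i<p))) ⟩
        (x ^ i * y ^ (p ∸ suc i) * y * (p ∸ i) ^ e) % p
          ≡⟨ cong (λ t → (t * (p ∸ i) ^ e) % p) (trans (*-assoc (x ^ i) _ y) (cong (x ^ i *_) yᵖ⁻ⁱ)) ⟩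
        (x ^ i * y ^ (p ∸ i) * (p ∸ i) ^ e) % p
          ≡⟨ *-cong≈ (*-congʳ≈ (y ^ (p ∸ i)) (^-cong≈ i (sym uy≈x))) ([p∸a]^even≈a^even i k (<⇒≤ i<p)) ⟩
        ((u * y) ^ i * y ^ (p ∸ i) * i ^ e) % p
          ≡⟨ cong (_% p) (trans (cong (λ t → t * y ^ (p ∸ i) * i ^ e) (^-distribʳ-* u y i))
                                (regroup (u ^ i) (y ^ i) (y ^ (p ∸ i)) (i ^ e))) ⟩
        (y ^ i * y ^ (p ∸ i) * (i ^ e * u ^ i)) % p
          ≡⟨ cong (λ t → (t * (i ^ e * u ^ i)) % p)
                  (trans (sym (^-distribˡ-+-* y i (p ∸ i))) (cong (y ^_) (m+[n∸m]≡n (<⇒≤ i<p)))) ⟩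
        (y ^ p * (i ^ e * u ^ i)) % p ∎
        where
        exponent : p ∸ 1 ∸ (p ∸ suc i) ≡ i
        exponent = trans (cong (p ∸ 1 ∸_) (sym (∸-+-assoc p 1 i))) (m∸[m∸n]≡n (∸-monoˡ-≤ 1 i<p))
        yᵖ⁻ⁱ : y ^ (p ∸ suc i) * y ≡ y ^ (p ∸ i)
        yᵖ⁻ⁱ = trans (*-comm _ y) (cong (y ^_) (sym (m∸n≡1+[m∸1+n] p i i<p)))

    ∑-power-moment≡mirimanoff : ∀ e → 0 < e → ∑ p (λ i → i ^ e * u ^ i) ≡ mirimanoff p (e + 1) u
    ∑-power-moment≡mirimanoff (suc e) _ = begin
      ∑ p (λ i → i ^ suc e * u ^ i)
        ≡⟨ cong (λ q → ∑ q (λ i → i ^ suc e * u ^ i)) (sym suc[p∸1]≡p) ⟩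
      ∑ (p ∸ 1) (λ i → suc i ^ suc e * u ^ suc i)
        ≡⟨ ∑-cong (p ∸ 1) (λ i _ → cong (λ t → suc i ^ t * u ^ suc i) (sym (m+n∸n≡m (suc e) 1))) ⟩
      ∑ (p ∸ 1) (λ i → suc i ^ (suc e + 1 ∸ 1) * u ^ suc i)
        ≡⟨ sym (sum-applyUpTo≡∑ (p ∸ 1) _) ⟩
      sum (applyUpTo (λ i → suc i ^ (suc e + 1 ∸ 1) * u ^ suc i) (p ∸ 1))
        ≡⟨ cong sum (sym (trans (cong (map _) (map-applyUpTo (λ i → i) suc (p ∸ 1))) (map-applyUpTo suc _ (p ∸ 1)))) ⟩
      mirimanoff p (suc e + 1) u ∎

    τ-even≈mirimanoff : ∀ k → 0 < k → τ (2 * k) ≈ y ^ p * mirimanoff p (2 * k + 1) u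
    τ-even≈mirimanoff k 0<k =
      trans (τ-even≈ k) (cong (λ t → (y ^ p * t) % p) (∑-power-moment≡mirimanoff (2 * k) (*-monoʳ-< 2 0<k)))

module Characters (p : ℕ) .{{_ : NonZero p}} (pr : Prime p) (2<p : 2 < p) (odd : p % 2 ≡ 1)
                  (s : ℕ) (gen : GeneratesUnits p s) where
  open Congruence p
  open PrimeModulus pr
  open Generator p pr 2<p s gen
  module Exponent = Congruence (p ∸ 1)
  open ≡-Reasoning

  m : ℕ
  m = (p ∸ 1) / 2

  2m≡p∸1 : 2 * m ≡ p ∸ 1
  2m≡p∸1 = begin
    2 * ((p ∸ 1) / 2)         ≡⟨ cong (λ t → 2 * (t / 2)) p∸1≡[p/2]*2 ⟩
    2 * (p / 2 * 2 / 2)       ≡⟨ cong (2 *_) (m*n/n≡m (p / 2) 2) ⟩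
    2 * (p / 2)               ≡⟨ *-comm 2 (p / 2) ⟩
    p / 2 * 2                 ≡⟨ sym p∸1≡[p/2]*2 ⟩
    p ∸ 1                     ∎
    where
    p∸1≡[p/2]*2 : p ∸ 1 ≡ p / 2 * 2
    p∸1≡[p/2]*2 = cong (_∸ 1) (trans (m≡m%n+[m/n]*n p 2) (cong (_+ p / 2 * 2) odd))

  m≉0 : ¬ (m ≈ 0)
  m≉0 = <p⇒≉0 0<m m<p
    where
    0<m : 0 < m
    0<m = *-cancelˡ-< 2 0 m (subst (0 <_) (sym 2m≡p∸1) (∸-monoˡ-< 1<p ≤-refl))
    m<p : m < p
    m<p = subst (m <_) suc[p∸1]≡p (s≤s (subst (m ≤_) 2m≡p∸1 (m≤n*m m 2)))

  -- -(2K + 1) mod p - 1; the 2 (p - 1) keeps the truncated subtraction honest up to K = m.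
  dualExponent : ℕ → ℕ
  dualExponent K = 2 * (p ∸ 1) ∸ suc (2 * K)

  χ : ℕ → ℕ → ℕ
  χ K k = s ^ (suc k * dualExponent K)

  exponent : ℕ → ℕ → ℕ
  exponent K K′ = dualExponent K + suc (2 * K′)

  χ-term : ∀ K K′ k → χ K k * (s ^ suc k) ^ suc (2 * K′) ≡ (s ^ exponent K K′) ^ suc k
  χ-term K K′ k = begin
    s ^ (suc k * D) * (s ^ suc k) ^ suc (2 * K′)
      ≡⟨ cong (s ^ (suc k * D) *_) (^-*-assoc s (suc k) (suc (2 * K′))) ⟩
    s ^ (suc k * D) * s ^ (suc k * suc (2 * K′))
      ≡⟨ sym (^-distribˡ-+-* s (suc k * D) (suc k * suc (2 * K′))) ⟩
    s ^ (suc k * D + suc k * suc (2 * K′))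
      ≡⟨ cong (s ^_) (trans (sym (*-distribˡ-+ (suc k) D (suc (2 * K′)))) (*-comm (suc k) (exponent K K′))) ⟩
    s ^ (exponent K K′ * suc k)
      ≡⟨ sym (^-*-assoc s (exponent K K′) (suc k)) ⟩
    (s ^ exponent K K′) ^ suc k ∎
    where
    D : ℕ
    D = dualExponent K

  module _ {K K′ : ℕ} (1≤K : 1 ≤ K) (K≤m : K ≤ m) (1≤K′ : 1 ≤ K′) (K′≤m : K′ ≤ m) where

    exponent+2K≡ : exponent K K′ + 2 * K ≡ 2 * (p ∸ 1) + 2 * K′
    exponent+2K≡ = begin
      D + suc (2 * K′) + 2 * K      ≡⟨ regroup D (2 * K) (2 * K′) ⟩
      D + suc (2 * K) + 2 * K′      ≡⟨ cong (_+ 2 * K′) (m∸n+n≡m 2K+1≤2[p∸1]) ⟩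
      2 * (p ∸ 1) + 2 * K′          ∎
      where
      D : ℕ
      D = dualExponent K
      regroup : ∀ D a b → D + suc b + a ≡ D + suc a + b
      regroup = solve-∀
      2K+1≤2[p∸1] : suc (2 * K) ≤ 2 * (p ∸ 1)
      2K+1≤2[p∸1] = ≤-trans (s≤s (≤-trans (*-monoʳ-≤ 2 K≤m) (≤-reflexive 2m≡p∸1)))
                            (≤-trans (+-monoˡ-≤ (p ∸ 1) (∸-monoˡ-< 1<p ≤-refl))
                                     (≤-reflexive (cong ((p ∸ 1) +_) (sym (+-identityʳ (p ∸ 1))))))

    exponent≈0⇒≡ : exponent K K′ % (p ∸ 1) ≡ 0 → K ≡ K′
    exponent≈0⇒≡ E≡0 =
      *-cancelˡ-≡ K K′ 2 (Exponent.≈-injective-on-[1,p] (0<2* 1≤K) (2*≤p∸1 K≤m) (0<2* 1≤K′) (2*≤p∸1 K′≤m) 2K≈2K′)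
      where
      0<2* : ∀ {k} → 1 ≤ k → 0 < 2 * k
      0<2* 1≤k = ≤-trans (s≤s z≤n) (*-monoʳ-≤ 2 1≤k)
      2*≤p∸1 : ∀ {k} → k ≤ m → 2 * k ≤ p ∸ 1
      2*≤p∸1 k≤m = ≤-trans (*-monoʳ-≤ 2 k≤m) (≤-reflexive 2m≡p∸1)
      2K≈2K′ : 2 * K Exponent.≈ 2 * K′
      2K≈2K′ = begin
        (2 * K) % (p ∸ 1)                    ≡⟨ sym (Exponent.+-congʳ≈ (2 * K) (Exponent.≡0⇒≈0 E≡0)) ⟩
        (exponent K K′ + 2 * K) % (p ∸ 1)    ≡⟨ cong (_% (p ∸ 1)) exponent+2K≡ ⟩
        (2 * (p ∸ 1) + 2 * K′) % (p ∸ 1)     ≡⟨ Exponent.+-congʳ≈ (2 * K′) (Exponent.*p≈0 2) ⟩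
        (0 + 2 * K′) % (p ∸ 1)               ∎

    exponent*m≈0 : (exponent K K′ * m) % (p ∸ 1) ≡ 0
    exponent*m≈0 = Exponent.≈0⇒≡0 (Exponent.+-cancelʳ≈ (2 * K * m) (begin
      (exponent K K′ * m + 2 * K * m) % (p ∸ 1)       ≡⟨ cong (_% (p ∸ 1)) (sym (*-distribʳ-+ m (exponent K K′) (2 * K))) ⟩
      ((exponent K K′ + 2 * K) * m) % (p ∸ 1)         ≡⟨ cong (λ t → (t * m) % (p ∸ 1)) exponent+2K≡ ⟩
      ((2 * (p ∸ 1) + 2 * K′) * m) % (p ∸ 1)          ≡⟨ cong (_% (p ∸ 1)) (*-distribʳ-+ m (2 * (p ∸ 1)) (2 * K′)) ⟩
      (2 * (p ∸ 1) * m + 2 * K′ * m) % (p ∸ 1)        ≡⟨ Exponent.+-cong≈ (2Xm≈0 (p ∸ 1)) (2Xm≈0 K′) ⟩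
      (0 + 0) % (p ∸ 1)                               ≡⟨ sym (Exponent.+-congˡ≈ 0 (2Xm≈0 K)) ⟩
      (0 + 2 * K * m) % (p ∸ 1)                       ∎))
      where
      2Xm≈0 : ∀ X → 2 * X * m Exponent.≈ 0
      2Xm≈0 X = trans (cong (_% (p ∸ 1)) (trans (reorder X m) (cong (X *_) 2m≡p∸1))) (Exponent.*p≈0 X)
        where
        reorder : ∀ X m → 2 * X * m ≡ X * (2 * m)
        reorder = solve-∀

    χ-orthogonal-≢ : K ≢ K′ → ∑ m (λ k → χ K k * (s ^ suc k) ^ suc (2 * K′)) ≈ 0
    χ-orthogonal-≢ K≢K′ = trans (cong (_% p) (∑-cong m (λ k _ → χ-term K K′ k)))
                                (∑-geometric≈0 m (s ^ exponent K K′) qᵐ≈1 q≉1)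
      where
      qᵐ≈1 : (s ^ exponent K K′) ^ m ≈ 1
      qᵐ≈1 = trans (cong (_% p) (^-*-assoc s (exponent K K′) m)) (∣⇒s^≈1 (exponent K K′ * m) exponent*m≈0)
      q≉1 : ¬ (s ^ exponent K K′ ≈ 1)
      q≉1 q≈1 = K≢K′ (exponent≈0⇒≡ (s^≈1⇒∣ (exponent K K′) q≈1))

  χ-orthogonal-≡ : ∀ {K} → 1 ≤ K → K ≤ m → ∑ m (λ k → χ K k * (s ^ suc k) ^ suc (2 * K)) ≈ m
  χ-orthogonal-≡ {K} 1≤K K≤m = trans (cong (_% p) (∑-cong m (λ k _ → χ-term K K k)))
                                     (∑-geometric-1 m (s ^ exponent K K) q≈1)
    where
    q≈1 : s ^ exponent K K ≈ 1
    q≈1 = ∣⇒s^≈1 (exponent K K)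
            (subst (λ e → e % (p ∸ 1) ≡ 0) (sym (+-cancelʳ-≡ (2 * K) _ _ (exponent+2K≡ 1≤K K≤m 1≤K K≤m)))
                   (m*n%n≡0 2 (p ∸ 1)))

module NonvanishingIndices (p : ℕ) .{{_ : NonZero p}} (u : ℕ) where

  mirimanoff≢0? : Decidable (λ k → ¬ (mirimanoff p (2 * k + 1) u % p ≡ 0))
  mirimanoff≢0? k = ¬? (mirimanoff p (2 * k + 1) u % p ≟ 0)

  candidates : List ℕ
  candidates = map suc (upTo ((p ∸ 1) / 2))

  K : Fin (rp p u) → ℕ
  K = lookup (filter mirimanoff≢0? candidates)

  K-bounds : ∀ i → 1 ≤ K i × K i ≤ (p ∸ 1) / 2
  K-bounds i = All.lookup (filter⁺ mirimanoff≢0? candidates-bounded) (∈-lookup i)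
    where
    candidates-bounded : All (λ k → 1 ≤ k × k ≤ (p ∸ 1) / 2) candidates
    candidates-bounded = subst (All _) (sym (map-applyUpTo (λ i → i) suc ((p ∸ 1) / 2)))
                               (applyUpTo⁺₁ suc ((p ∸ 1) / 2) (λ i<m → s≤s z≤n , i<m))

  K-nonvanishing : ∀ i → ¬ (mirimanoff p (2 * K i + 1) u % p ≡ 0)
  K-nonvanishing i = All.lookup (all-filter mirimanoff≢0? candidates) (∈-lookup i)

  K-injective : ∀ i j → K i ≡ K j → i ≡ j
  K-injective = lookup-injective (Unique.filter⁺ mirimanoff≢0? (Unique.map⁺ suc-injective (Unique.upTo⁺ ((p ∸ 1) / 2))))

module DualityArgument (p : ℕ) .{{_ : NonZero p}} (pr : Prime p) (odd : p % 2 ≡ 1)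
         (s : ℕ) (gen : GeneratesUnits p s)
         (x y : ℕ) (y≢0 : ¬ (y % p ≡ 0)) (x≈y+1 : x % p ≡ (y + 1) % p)
         (z : Fin ((p ∸ 1) / 2) → R p)
         (zℓ≈ℓ : ∀ k → EqR p (mulR p (z k) (linR p x y (p ∸ s ^ suc (toℕ k) % p))) (linR p x y (s ^ suc (toℕ k))))
         (u : ℕ) (uy≈x : (u * y) % p ≡ x % p) where
  open LogarithmicDerivative p
  open PrimeModulus pr
  open Generator p pr (odd-prime⇒2<p pr odd) s gen
  open Characters p pr (odd-prime⇒2<p pr odd) odd s gen
  open BinomialUnits p x y
  open NonvanishingIndices p u
  open ≡-Reasoning

  xᵖ≈1+yᵖ : x ^ p ≈ 1 + y ^ p
  xᵖ≈1+yᵖ = trans (frobenius x) (trans x≈y+1 (trans (cong (_% p) (+-comm y 1)) (+-congˡ≈ 1 (sym (frobenius y)))))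

  open Inverse xᵖ≈1+yᵖ

  A : Fin m → ℕ
  A k = s ^ suc (toℕ k)

  z̃ : Fin m → R p
  z̃ k = ℓ (neg (A k)) · ℓ⁻¹ (A k)

  zℓ≋ℓ : ∀ k → z k · ℓ (neg (A k)) ≋ ℓ (A k)
  zℓ≋ℓ k = ≋-trans (≋-sym (mulR≋· (z k) (ℓ (neg (A k))))) (mk≋ (zℓ≈ℓ k))

  z·z̃≋𝟙 : ∀ k → z k · z̃ k ≋ 𝟙
  z·z̃≋𝟙 k = ratio-inverse (A k) (zℓ≋ℓ k)

  ℒ-prodPow-z : ∀ K (c : Fin m → ℕ) →
    ℒ (2 * K) (prodPowR p m z c) (prodPow (allFin m) z̃ c) + 2 * τ (2 * K) * sumFin m (λ k → c k * A k ^ suc (2 * K)) ≈ 0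
  ℒ-prodPow-z K c = begin
    (ℒ e (prodPowR p m z c) (prodPow (allFin m) z̃ c) + 2 * τ e * sumFin m (λ k → c k * A k ^ suc e)) % p
      ≡⟨ +-congʳ≈ _ (trans (ℒ-cong e (prodPowR≋prodPow m z c) ≋-refl) (ℒ-prodPow e (allFin m) c z·z̃≋𝟙)) ⟩
    (sumFin m (λ k → c k * ℒ e (z k) (z̃ k)) + 2 * τ e * sumFin m (λ k → c k * A k ^ suc e)) % p
      ≡⟨ cong (λ t → (sumFin m (λ k → c k * ℒ e (z k) (z̃ k)) + t) % p) (sym (sum-map-*ˡ (allFin m) (2 * τ e) _)) ⟩
    (sumFin m (λ k → c k * ℒ e (z k) (z̃ k)) + sumFin m (λ k → 2 * τ e * (c k * A k ^ suc e))) % p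
      ≡⟨ cong (_% p) (sym (sum-map-+ (allFin m) _ _)) ⟩
    sumFin m (λ k → c k * ℒ e (z k) (z̃ k) + 2 * τ e * (c k * A k ^ suc e)) % p
      ≡⟨ sum-map-cong≈ (allFin m) (λ k → trans (cong (_% p) (factor (c k) _ (τ e) (A k ^ suc e)))
                                                (trans (*-congˡ≈ (c k) (ℒ-ratio K (A k) (zℓ≋ℓ k))) (cong (_% p) (*-zeroʳ (c k))))) ⟩
    sumFin m (λ _ → 0) % p
      ≡⟨ cong (_% p) (sum-map-0 (allFin m)) ⟩
    0 % p ∎
    where
    e : ℕ
    e = 2 * K
    factor : ∀ c L t a → c * L + 2 * t * (c * a) ≡ c * (L + 2 * (a * t))
    factor = solve-∀

  a : Fin (rp p u) → Fin m → ℕ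
  a i k = χ (K i) (toℕ k)

  V Ṽ : Fin (rp p u) → R p
  V i = prodPowR p m z (a i)
  Ṽ i = prodPow (allFin m) z̃ (a i)

  V·Ṽ≋𝟙 : ∀ i → V i · Ṽ i ≋ 𝟙
  V·Ṽ≋𝟙 i = ≋-trans (·-congʳ (Ṽ i) (prodPowR≋prodPow m z (a i))) (prodPow-inverse (allFin m) (a i) z·z̃≋𝟙)

  ℒ-V : ∀ i j → ℒ (2 * K j) (V i) (Ṽ i) + 2 * τ (2 * K j) * ∑ m (λ k → χ (K i) k * (s ^ suc k) ^ suc (2 * K j)) ≈ 0
  ℒ-V i j = trans (cong (λ S → (ℒ (2 * K j) (V i) (Ṽ i) + 2 * τ (2 * K j) * S) % p) (sym (sumFin≡∑ m _ _ (λ k → refl))))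
                  (ℒ-prodPow-z (K j) (a i))

  τ≉0 : ∀ j → ¬ (τ (2 * K j) ≈ 0)
  τ≉0 j τ≈0 = *-≉0 (^-≉0 p (y≢0 ∘ ≈0⇒≡0)) (K-nonvanishing j ∘ ≈0⇒≡0)
                   (trans (sym (τ-even≈mirimanoff u uy≈x (K j) (proj₁ (K-bounds j)))) τ≈0)

  off-diagonal : ∀ i j → i ≢ j → ℒ (2 * K j) (V i) (Ṽ i) ≈ 0
  off-diagonal i j i≢j =
    +≈0∧≈0⇒≈0ˡ (ℒ-V i j) (trans (*-congˡ≈ (2 * τ (2 * K j)) orthogonal) (cong (_% p) (*-zeroʳ (2 * τ (2 * K j)))))
    where
    orthogonal : ∑ m (λ k → χ (K i) k * (s ^ suc k) ^ suc (2 * K j)) ≈ 0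
    orthogonal = χ-orthogonal-≢ (proj₁ (K-bounds i)) (proj₂ (K-bounds i)) (proj₁ (K-bounds j)) (proj₂ (K-bounds j))
                                (i≢j ∘ K-injective i j)

  diagonal : ∀ j → ¬ (ℒ (2 * K j) (V j) (Ṽ j) ≈ 0)
  diagonal j ℒ≈0 = *-≉0 (*-≉0 (<p⇒≉0 z<s (odd-prime⇒2<p pr odd)) (τ≉0 j)) m≉0
    (trans (sym (*-congˡ≈ (2 * τ (2 * K j)) (χ-orthogonal-≡ (proj₁ (K-bounds j)) (proj₂ (K-bounds j)))))
           (+≈0∧≈0⇒≈0ʳ (ℒ-V j j) ℒ≈0))

mainTheorem17 : (p : ℕ) .{{_ : NonZero p}} → Prime p → p % 2 ≡ 1 →
    (s : ℕ) → GeneratesUnits p s →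
    (x y : ℕ) → ¬ (x % p ≡ 0) → ¬ (y % p ≡ 0) → x % p ≡ (y + 1) % p →
    (z : Fin ((p ∸ 1) / 2) → R p) →
    (∀ k → EqR p (mulR p (z k) (linR p x y (p ∸ s ^ suc (toℕ k) % p)))
                  (linR p x y (s ^ suc (toℕ k)))) →
    (u : ℕ) → (u * y) % p ≡ x % p →
    DimSpanAtLeast p ((p ∸ 1) / 2) z (rp p u)
mainTheorem17 p pr odd s gen x y _ y≢0 x≈y+1 z zℓ≈ℓ u uy≈x =
  a , linIndep-of-diagonal p pr (rp p u) V Ṽ V·Ṽ≋𝟙 (λ j → 2 * K j) off-diagonal diagonal
  where
  open DualityArgument p pr odd s gen x y y≢0 x≈y+1 z zℓ≈ℓ u uy≈x
  open NonvanishingIndices p u using (K)
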